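{- Let $\mathrm{VC}$ be the vertex-cover DP-core without size bound, and let $\tau$ be a $k$-instructive tree decomposition. Then $\mathrm{Inv}[\mathrm{VC},\mathcal{I}](G(\tau))$ is the binary encoding of the minimum size of a vertex cover in $G(\tau)$.
   Context: A graph is $G=(V,E,I)$ with $V,E$ finite subsets of $\mathbb{N}$, $I\subseteq E\times V$; a vertex cover is a set of vertices meeting every edge; $\simeq$ is isomorphism. Instructive tree decompositions: $\Sigma_k$ consists of $\mathrm{Leaf}$ (arity 0), $\mathrm{IntroVertex}_u$, $\mathrm{ForgetVertex}_u$, $\mathrm{IntroEdge}_{u,v}$ (arity 1), $\mathrm{Join}$ (arity 2), $u\ne v\in[k+1]$. $L_k$ (the $k$-instructive tree decompositions) is the set of terms accepted by the tree automaton with states all $B\subseteq[k+1]$ (all final), transitions $\mathrm{Leaf}\to\emptyset$; $\mathrm{IntroVertex}_u(B)\to B\cup\{u\}$ ($u\notin B$); $\mathrm{ForgetVertex}_u(B)\to B\setminus\{u\}$ ($u\in B$); $\mathrm{IntroEdge}_{u,v}(B)\to B$ ($u,v\in B$); $\mathrm{Join}(B,B)\to B$. Graph $G(\tau)$ with active labelled vertices: $\mathrm{Leaf}$: empty graph; $\mathrm{IntroVertex}_u$: add new vertex labelled $u$; $\mathrm{ForgetVertex}_u$: remove label $u$; $\mathrm{IntroEdge}_{u,v}$: add a new edge between the vertices labelled $u,v$; $\mathrm{Join}(\sigma_1,\sigma_2)$: glue disjoint copies of $G(\sigma_1),G(\sigma_2)$ identifying equally labelled active vertices. $\mathcal{I}=\{(\Sigma_k,L_k,G|_{L_k})\}_k$.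 For a DP-core with components $\hat a$, $\mathrm{Clean}_k$, $\mathrm{Inv}_k$: $\hat a(S_1,\dots,S_p)=\mathrm{Clean}_k(\bigcup_{w_i\in S_i}\hat a(w_1,\dots,w_p))$, $\mathrm{Dyn}_k(\mathrm{Leaf})=\widehat{\mathrm{Leaf}}$, $\mathrm{Dyn}_k(a(\tau_1,\dots))=\hat a(\mathrm{Dyn}_k(\tau_1),\dots)$. $\mathrm{Inv}[\mathrm{VC},\mathcal{I}](G)$ is $\mathrm{Inv}_{k'}(\mathrm{Dyn}_{k'}(\tau'))$ for any $\tau'\in L_{k'}$ with $G(\tau')\simeq G$, $k'$ minimal with $\tau'\in L_{k'}$. $\mathrm{VC}[k]$: witnesses $(R,s)$ with $R\subseteq[k+1]$, $s\in\mathbb{N}$, all final; $\mathrm{Clean}(S)$ keeps $(R,s)\in S$ iff no $(R,s')\in S$ with $s'<s$; $\mathrm{Inv}(S)=\min\{s:(R,s)\in S\}$ (in binary); $\widehat{\mathrm{Leaf}}=\{(\emptyset,0)\}$; $\widehat{\mathrm{IntroVertex}_u}(w)=\{w\}$; $\widehat{\mathrm{ForgetVertex}_u}(R,s)=\{(R\setminus\{u\},s)\}$; $\widehat{\mathrm{IntroEdge}_{u,v}}(R,s)=\{(R,s)\}$ if $u\in R$ or $v\in R$, else $\{(R\cup\{u\},s+1),(R\cup\{v\},s+1)\}$; $\widehat{\mathrm{Join}}((R,s),(R',s'))=\{(R\cup R',s+s'-|R\cap R'|)\}$. -}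

module Defs where

open import Data.Nat using (ℕ; zero; suc; _+_; _∸_; _⊔_; _≤_; _<_; _≡ᵇ_; _<ᵇ_)
open import Data.Bool using (Bool; true; false; not; _∧_; if_then_else_)
import Data.Bool as B
open import Data.Fin using (Fin; toℕ)
open import Data.Fin.Subset using (Subset; ⊥; ⁅_⁆; _∪_; _∩_; _-_; _∈_; _∉_; ∣_∣)
open import Data.Fin.Subset.Properties using (_∈?_)
open import Data.Vec.Properties using (≡-dec)
open import Data.List using (List; []; _∷_; _++_; map; filterᵇ; concatMap; foldr; length)
open import Data.Bool.ListAction using (any)
open import Data.List.Membership.Propositional using () renaming (_∈_ to _∈ₗ_)
open import Data.List.Relation.Unary.All using (All)
open import Data.List.Relation.Unary.Unique.Propositional using (Unique)
open import Data.Maybe using (Maybe; just; nothing)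
open import Data.Product using (Σ; ∃; _×_; _,_; proj₁; proj₂)
open import Relation.Nullary using (¬_; does; Dec)
open import Relation.Binary.PropositionalEquality using (_≡_; _≢_)

-- Graphs G = (V, E, I): V, E finite subsets of ℕ (duplicate-free lists),
-- I ⊆ E × V (list of incidence pairs (e , v)).

record Graph : Set where
  constructor mkGraph
  field
    V : List ℕ
    E : List ℕ
    I : List (ℕ × ℕ)
open Graph public

record IsVertexCover (G : Graph) (C : List ℕ) : Set where
  field
    unique  : Unique C
    subset  : All (_∈ₗ V G) C
    covers  : ∀ e → e ∈ₗ E G → ∃ λ v → ((e , v) ∈ₗ I G) × (v ∈ₗ C)

IsMinVCSize : Graph → ℕ → Set
IsMinVCSize G n =
  (∃ λ C → IsVertexCover G C × length C ≡ n) ×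
  (∀ C → IsVertexCover G C → n ≤ length C)

record FinBij (A B : List ℕ) (f : ℕ → ℕ) : Set where
  field
    g    : ℕ → ℕ
    f∈   : ∀ a → a ∈ₗ A → f a ∈ₗ B
    g∈   : ∀ b → b ∈ₗ B → g b ∈ₗ A
    gf   : ∀ a → a ∈ₗ A → g (f a) ≡ a
    fg   : ∀ b → b ∈ₗ B → f (g b) ≡ b

record _≃_ (G H : Graph) : Set where
  field
    fV    : ℕ → ℕ
    fE    : ℕ → ℕ
    bijV  : FinBij (V G) (V H) fV
    bijE  : FinBij (E G) (E H) fE
    inc→  : ∀ e v → e ∈ₗ E G → v ∈ₗ V G → (e , v) ∈ₗ I G → (fE e , fV v) ∈ₗ I H
    inc←  : ∀ e v → e ∈ₗ E G → v ∈ₗ V G → (fE e , fV v) ∈ₗ I H → (e , v) ∈ₗ I G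

-- Terms over the alphabets Σ_k (labels are natural numbers; the label u
-- of Σ_k ranges over [k+1] = {1,…,k+1}).

data Term : Set where
  Leaf         : Term
  IntroVertex  : ℕ → Term → Term
  ForgetVertex : ℕ → Term → Term
  IntroEdge    : ℕ → ℕ → Term → Term
  Join         : Term → Term → Term

-- Lab k u : u ∈ [k+1]; the label u = i+1 is represented by i : Fin (k+1).
data Lab (k : ℕ) : ℕ → Set where
  lab : (i : Fin (suc k)) → Lab k (suc (toℕ i))

idx : ∀ {k u} → Lab k u → Fin (suc k)
idx (lab i) = i

data Over (k : ℕ) : Term → Set where
  leaf : Over k Leaf
  iv   : ∀ {u τ} → Lab k u → Over k τ → Over k (IntroVertex u τ)
  fv   : ∀ {u τ} → Lab k u → Over k τ → Over k (ForgetVertex u τ)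
  ie   : ∀ {u v τ} → Lab k u → Lab k v → u ≢ v → Over k τ → Over k (IntroEdge u v τ)
  jn   : ∀ {τ₁ τ₂} → Over k τ₁ → Over k τ₂ → Over k (Join τ₁ τ₂)

-- Runs of the tree automaton for L_k; states are subsets B ⊆ [k+1]
-- (label i+1 ↔ i : Fin (k+1)).
data Run (k : ℕ) : Term → Subset (suc k) → Set where
  leaf : Run k Leaf ⊥
  iv   : ∀ {u τ B} (l : Lab k u) → Run k τ B → idx l ∉ B →
         Run k (IntroVertex u τ) (B ∪ ⁅ idx l ⁆)
  fv   : ∀ {u τ B} (l : Lab k u) → Run k τ B → idx l ∈ B →
         Run k (ForgetVertex u τ) (B - idx l)
  ie   : ∀ {u v τ B} (l : Lab k u) (l' : Lab k v) → u ≢ v → Run k τ B →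
         idx l ∈ B → idx l' ∈ B → Run k (IntroEdge u v τ) B
  jn   : ∀ {τ₁ τ₂ B} → Run k τ₁ B → Run k τ₂ B → Run k (Join τ₁ τ₂) B

-- L_k : all states are final.
_∈L_ : Term → ℕ → Set
τ ∈L k = ∃ λ B → Run k τ B

run⇒over : ∀ {k τ B} → Run k τ B → Over k τ
run⇒over leaf = leaf
run⇒over (iv l r _) = iv l (run⇒over r)
run⇒over (fv l r _) = fv l (run⇒over r)
run⇒over (ie l l' d r _ _) = ie l l' d (run⇒over r)
run⇒over (jn r s) = jn (run⇒over r) (run⇒over s)

inL⇒over : ∀ {k τ} → τ ∈L k → Over k τ
inL⇒over (_ , r) = run⇒over r

-- The graph G(τ), with active labelled vertices.
-- act : list of (label , vertex) pairs of active vertices (first match wins).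

record LGraph : Set where
  constructor mkLG
  field
    lV   : List ℕ
    lE   : List ℕ
    lI   : List (ℕ × ℕ)
    act  : List (ℕ × ℕ)
open LGraph

fresh : List ℕ → ℕ
fresh xs = suc (foldr _⊔_ 0 xs)

lookupLab : ℕ → List (ℕ × ℕ) → Maybe ℕ
lookupLab u [] = nothing
lookupLab u ((u' , x) ∷ as) = if u ≡ᵇ u' then just x else lookupLab u as

labelOf : ℕ → List (ℕ × ℕ) → Maybe ℕ
labelOf x [] = nothing
labelOf x ((u , x') ∷ as) = if x ≡ᵇ x' then just u else labelOf x as

-- vertex of the first operand with which vertex x of the second operand
-- of a Join is identified (same active label), if any
glue : LGraph → LGraph → ℕ → Maybe ℕ
glue G₁ G₂ x with labelOf x (act G₂)
... | nothing = nothing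
... | just u  = lookupLab u (act G₁)

isNothing : Maybe ℕ → Bool
isNothing nothing  = true
isNothing (just _) = false

-- Join: disjoint copies (second operand shifted), equally labelled active
-- vertices identified.
joinLG : LGraph → LGraph → LGraph
joinLG G₁ G₂ =
  mkLG (lV G₁ ++ map (m +_) (filterᵇ (λ x → isNothing (glue G₁ G₂ x)) (lV G₂)))
       (lE G₁ ++ map (n +_) (lE G₂))
       (lI G₁ ++ map (λ p → (n + proj₁ p , φ (proj₂ p))) (lI G₂))
       (act G₁ ++ map (λ p → (proj₁ p , φ (proj₂ p))) (act G₂))
  where
  m = fresh (lV G₁)
  n = fresh (lE G₁)
  ren : Maybe ℕ → ℕ → ℕ
  ren (just w) x = w
  ren nothing  x = m + x
  φ : ℕ → ℕ
  φ x = ren (glue G₁ G₂ x) x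

LG : Term → LGraph
LG Leaf = mkLG [] [] [] []
LG (IntroVertex u τ) =
  let G = LG τ ; x = fresh (lV G) in
  mkLG (x ∷ lV G) (lE G) (lI G) ((u , x) ∷ act G)
LG (ForgetVertex u τ) =
  let G = LG τ in
  mkLG (lV G) (lE G) (lI G) (filterᵇ (λ p → not (proj₁ p ≡ᵇ u)) (act G))
LG (IntroEdge u v τ) = addEdge (LG τ) (lookupLab u (act (LG τ))) (lookupLab v (act (LG τ)))
  where
  addEdge : LGraph → Maybe ℕ → Maybe ℕ → LGraph
  addEdge G (just x) (just y) =
    mkLG (lV G) (fresh (lE G) ∷ lE G) ((fresh (lE G) , x) ∷ (fresh (lE G) , y) ∷ lI G) (act G)
  addEdge G _ _ = G   -- does not occur for τ ∈ L_k
LG (Join τ₁ τ₂) = joinLG (LG τ₁) (LG τ₂)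

G⟦_⟧ : Term → Graph
G⟦ τ ⟧ = mkGraph (lV (LG τ)) (lE (LG τ)) (lI (LG τ))

-- The DP-core VC[k] (no size bound).  Witness sets are lists.

W : ℕ → Set
W k = Subset (suc k) × ℕ

_≟S_ : ∀ {n} (p q : Subset n) → Dec (p ≡ q)
_≟S_ = ≡-dec B._≟_

Clean : ∀ {k} → List (W k) → List (W k)
Clean S = filterᵇ (λ w → not (any (λ w' → does (proj₁ w' ≟S proj₁ w) ∧ (proj₂ w' <ᵇ proj₂ w)) S)) S

lift₁ : ∀ {k} → (W k → List (W k)) → List (W k) → List (W k)
lift₁ f S = Clean (concatMap f S)

lift₂ : ∀ {k} → (W k → W k → List (W k)) → List (W k) → List (W k) → List (W k)
lift₂ f S₁ S₂ = Clean (concatMap (λ w₁ → concatMap (λ w₂ → f w₁ w₂) S₂) S₁)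

introEdgeW : ∀ {k} → Fin (suc k) → Fin (suc k) → W k → List (W k)
introEdgeW u v (R , s) with does (u ∈? R) B.∨ does (v ∈? R)
... | true  = (R , s) ∷ []
... | false = (R ∪ ⁅ u ⁆ , suc s) ∷ (R ∪ ⁅ v ⁆ , suc s) ∷ []

joinW : ∀ {k} → W k → W k → List (W k)
joinW (R , s) (R' , s') = (R ∪ R' , s + s' ∸ ∣ R ∩ R' ∣) ∷ []

Dyn : (k : ℕ) {τ : Term} → Over k τ → List (W k)
Dyn k leaf = (⊥ , 0) ∷ []
Dyn k (iv l o) = lift₁ (λ w → w ∷ []) (Dyn k o)
Dyn k (fv l o) = lift₁ (λ w → (proj₁ w - idx l , proj₂ w) ∷ []) (Dyn k o)
Dyn k (ie l l' _ o) = lift₁ (introEdgeW (idx l) (idx l')) (Dyn k o)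
Dyn k (jn o o') = lift₂ joinW (Dyn k o) (Dyn k o')

InvIs : ∀ {k} → List (W k) → ℕ → Set
InvIs S n = (n ∈ₗ map proj₂ S) × All (n ≤_) (map proj₂ S)

InvVCIs : Graph → ℕ → Set
InvVCIs G n =
  ∀ k' τ' → (p : τ' ∈L k') → (∀ j → τ' ∈L j → k' ≤ j) → G⟦ τ' ⟧ ≃ G →
  InvIs (Dyn k' (inL⇒over p)) n

-- Along a run of the automaton with final state B, activeVertex maps each label of B injectively
-- to the active vertex of G(τ) carrying it.  For this labelling the table computed by Dyn is sound
-- and complete for vertex covers: every entry (R , s) is realised by a cover of size at most s
-- whose trace on the active vertices is R, and for every cover P with trace A there is an entry
-- (R , s) with R ⊆ A and s − |R| ≤ |P| − |A|.  Both facts are proved by induction on the run; at a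
-- Join the two covers are merged and the |R₁ ∩ R₂| active vertices they share are counted once,
-- which is exactly the correction made by the DP-core.  Hence the least s in the table is the size
-- of some vertex cover and a lower bound for all of them, i.e. the vertex cover number, and since
-- that number is invariant under isomorphism, Inv[VC, I] returns it.

module Submission where

open import Defs
open import Data.Bool using (Bool; true; false; not; _∧_; _∨_; T; if_then_else_)
open import Data.Bool.Properties using (T-≡; ∨-identityʳ; ∨-zeroʳ; ∧-conicalˡ; ∧-conicalʳ)
open import Data.Empty using (⊥-elim)
open import Data.Fin.Subset using (Subset; ⊥; ⁅_⁆; _∪_; _∩_; _-_; ∣_∣)
  renaming (_∈_ to _∈ₛ_; _∉_ to _∉ₛ_; _⊆_ to _⊆ₛ_)
open import Data.Fin.Subset.Properties
  using (x∈⁅x⁆; x∈⁅y⁆⇒x≡y; x≢y⇒x∉⁅y⁆; x∈p∪q⁻; x∈p∪q⁺; x∈p∧x≢y⇒x∈p-y; p─⊥≡p; ∪-identityʳ;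
         p⊆q⇒∣p∣≤∣q∣; ∣p∩q∣≤∣p∣; ∉⊥; _∈?_)
open import Data.Fin using (Fin; zero; suc; toℕ)
import Data.Fin.Properties as Fin
open import Data.List using (List; []; _∷_; _++_; map; filterᵇ; concatMap; length; allFin)
open import Data.List.Properties using (length-++; length-map; map-tabulate)
open import Data.List.Membership.Propositional using (_∈_; _∉_; find; lose)
open import Data.List.Membership.Propositional.Properties
  using (∈-++⁺ˡ; ∈-++⁺ʳ; ∈-++⁻; ∈-map⁺; ∈-map⁻; ∈-∃++; ∈-allFin; ∈-filter⁺; ∈-filter⁻;
         ∈-concatMap⁺; ∈-concatMap⁻)
open import Data.List.Relation.Binary.Subset.Propositional using (_⊆_)
open import Data.Bool.ListAction using (any)
open import Data.List.Relation.Unary.Any using (here; there)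
open import Data.List.Relation.Unary.Any.Properties using (any⁻)
open import Data.List.Relation.Unary.All as All using ([]; _∷_)
open import Data.List.Relation.Unary.All.Properties as All using ()
open import Data.List.Relation.Unary.AllPairs using ([]; _∷_)
open import Data.List.Extrema.Nat using (argmin; argmin-sel; f[argmin]≤f[xs])
open import Data.List.Relation.Unary.Unique.Propositional using (Unique)
import Data.List.Relation.Unary.Unique.Propositional.Properties as Unique
open import Data.Nat using (ℕ; zero; suc; _+_; _∸_; _≤_; _<_; _≡ᵇ_; _<ᵇ_; z≤n; s≤s)
open import Data.Nat.Properties
open import Data.List.Membership.DecPropositional _≟_ using () renaming (_∈?_ to _∈ℕ?_)
open import Data.Nat.Induction using (<-rec)
open import Data.Nat.Tactic.RingSolver using (solve-∀)
open import Data.Vec using ([]; _∷_; lookup; _[_]≔_; here; there)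
import Data.Vec as Vec
open import Data.Vec.Functional using (updateAt)
open import Data.Vec.Functional.Properties using (updateAt-updates; updateAt-minimal)
open import Data.Vec.Properties
  using ([]=⇒lookup; lookup⇒[]=; lookup-zipWith; lookup∘update; lookup∘update′; lookup∘tabulate)
open import Data.Maybe using (Maybe; just; nothing)
open import Data.Maybe.Properties using (just-injective)
open import Data.Product using (Σ; ∃; _×_; _,_; proj₁; proj₂; swap)
open import Data.Sum using (_⊎_; inj₁; inj₂; [_,_]′)
open import Function using (_∘_; id; Equivalence)
open import Relation.Binary.PropositionalEquality
open import Relation.Nullary using (¬_; Dec; yes; no; does)
open import Relation.Nullary.Decidable using (T?; isYes; toWitness; fromWitness)

open LGraph

bit : Bool → ℕ
bit true  = 1
bit false = 0

countᵇ : {A : Set} → (A → Bool) → List A → ℕ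
countᵇ p []       = 0
countᵇ p (x ∷ xs) = bit (p x) + countᵇ p xs

module _ {A : Set} where

  length-filterᵇ : ∀ (p : A → Bool) xs → length (filterᵇ p xs) ≡ countᵇ p xs
  length-filterᵇ p []       = refl
  length-filterᵇ p (x ∷ xs) with p x
  ... | true  = cong suc (length-filterᵇ p xs)
  ... | false = length-filterᵇ p xs

  countᵇ-++ : ∀ (p : A → Bool) xs ys → countᵇ p (xs ++ ys) ≡ countᵇ p xs + countᵇ p ys
  countᵇ-++ p []       ys = refl
  countᵇ-++ p (x ∷ xs) ys =
    trans (cong (bit (p x) +_) (countᵇ-++ p xs ys)) (sym (+-assoc (bit (p x)) _ _))

  countᵇ-map : ∀ {B : Set} (p : B → Bool) (f : A → B) xs → countᵇ p (map f xs) ≡ countᵇ (p ∘ f) xs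
  countᵇ-map p f []       = refl
  countᵇ-map p f (x ∷ xs) = cong (bit (p (f x)) +_) (countᵇ-map p f xs)

  countᵇ-filterᵇ : ∀ (p q : A → Bool) xs → countᵇ p (filterᵇ q xs) ≡ countᵇ (λ x → q x ∧ p x) xs
  countᵇ-filterᵇ p q []       = refl
  countᵇ-filterᵇ p q (x ∷ xs) with q x
  ... | true  = cong (bit (p x) +_) (countᵇ-filterᵇ p q xs)
  ... | false = countᵇ-filterᵇ p q xs

  countᵇ-cong : ∀ {p q : A → Bool} xs → (∀ {x} → x ∈ xs → p x ≡ q x) → countᵇ p xs ≡ countᵇ q xs
  countᵇ-cong []       p≗q = refl
  countᵇ-cong (x ∷ xs) p≗q = cong₂ _+_ (cong bit (p≗q (here refl))) (countᵇ-cong xs (p≗q ∘ there))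

  countᵇ-split : ∀ (h p : A → Bool) xs →
    countᵇ p xs ≡ countᵇ (λ x → h x ∧ p x) xs + countᵇ (λ x → not (h x) ∧ p x) xs
  countᵇ-split h p []       = refl
  countᵇ-split h p (x ∷ xs) with h x | p x
  ... | true  | true  = cong suc (countᵇ-split h p xs)
  ... | true  | false = countᵇ-split h p xs
  ... | false | true  = trans (cong suc (countᵇ-split h p xs)) (sym (+-suc _ _))
  ... | false | false = countᵇ-split h p xs

  Unique-length-≤ : ∀ {xs ys : List A} → Unique xs → xs ⊆ ys → length xs ≤ length ys
  Unique-length-≤ {[]}     _          _     = z≤n
  Unique-length-≤ {x ∷ xs} (x∉xs ∷ u) xs⊆ys with ∈-∃++ (xs⊆ys (here refl))
  ... | ys₁ , ys₂ , refl = begin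
    suc (length xs)           ≤⟨ s≤s (Unique-length-≤ u xs⊆ys₁ys₂) ⟩
    suc (length (ys₁ ++ ys₂)) ≡⟨ cong suc (length-++ ys₁) ⟩
    suc (length ys₁ + length ys₂) ≡⟨ sym (+-suc (length ys₁) _) ⟩
    length ys₁ + length (x ∷ ys₂) ≡⟨ sym (length-++ ys₁) ⟩
    length (ys₁ ++ x ∷ ys₂)   ∎
    where
    open ≤-Reasoning
    xs⊆ys₁ys₂ : xs ⊆ ys₁ ++ ys₂
    xs⊆ys₁ys₂ {y} y∈xs with ∈-++⁻ ys₁ (xs⊆ys (there y∈xs))
    ... | inj₁ y∈ys₁               = ∈-++⁺ˡ y∈ys₁
    ... | inj₂ (here refl)         = ⊥-elim (All.lookup x∉xs y∈xs refl)
    ... | inj₂ (there y∈ys₂)       = ∈-++⁺ʳ ys₁ y∈ys₂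

  Unique-map⁺ : ∀ {B : Set} {f : A → B} {xs} →
    (∀ {x y} → x ∈ xs → y ∈ xs → f x ≡ f y → x ≡ y) → Unique xs → Unique (map f xs)
  Unique-map⁺ {xs = []}            _   []         = []
  Unique-map⁺ {f = f} {xs = x ∷ xs} inj (x∉xs ∷ u) =
    All.tabulate fx∉ ∷ Unique-map⁺ (λ p q → inj (there p) (there q)) u
    where
    fx∉ : ∀ {z} → z ∈ map f xs → f x ≢ z
    fx∉ z∈ fx≡z with ∈-map⁻ _ z∈
    ... | y , y∈xs , refl = All.lookup x∉xs y∈xs (inj (here refl) (there y∈xs) fx≡z)

-- The equation lets Agda read f off the shape of ys, even when f is not nameable.
∈-++-map⁺ : ∀ {A B : Set} {f : A → B} {x xs ys} zs → ys ≡ zs ++ map f xs → x ∈ xs → f x ∈ ys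
∈-++-map⁺ zs refl x∈ = ∈-++⁺ʳ zs (∈-map⁺ _ x∈)

T⇒≡true : ∀ {b} → T b → b ≡ true
T⇒≡true = Equivalence.to T-≡

≡true⇒T : ∀ {b} → b ≡ true → T b
≡true⇒T = Equivalence.from T-≡

≡ᵇ-refl : ∀ m → (m ≡ᵇ m) ≡ true
≡ᵇ-refl m = T⇒≡true (≡⇒≡ᵇ m m refl)

≢⇒≡ᵇ≡false : ∀ {m n} → m ≢ n → (m ≡ᵇ n) ≡ false
≢⇒≡ᵇ≡false {m} {n} m≢n with m ≡ᵇ n in eq
... | true  = ⊥-elim (m≢n (≡ᵇ⇒≡ m n (≡true⇒T eq)))
... | false = refl

T-not-≡ᵇ⇒≢ : ∀ {m n} → T (not (m ≡ᵇ n)) → m ≢ n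
T-not-≡ᵇ⇒≢ {m} t refl with m ≡ᵇ m | ≡⇒≡ᵇ m m refl
... | true  | _ = t

isNothing-true : ∀ {mb : Maybe ℕ} → isNothing mb ≡ true → mb ≡ nothing
isNothing-true {nothing} _ = refl

private variable
  n : ℕ

lookup-∉ : ∀ {p : Subset n} {i} → i ∉ₛ p → lookup p i ≡ false
lookup-∉ {p = p} {i = i} i∉p with lookup p i in eq
... | true  = ⊥-elim (i∉p (lookup⇒[]= i p eq))
... | false = refl

lookup-- : ∀ (p : Subset n) {i j} → i ≢ j → lookup (p - j) i ≡ lookup p i
lookup-- (b ∷ p) {zero}  {zero}  i≢j = ⊥-elim (i≢j refl)
lookup-- (b ∷ p) {zero}  {suc j} i≢j = refl
lookup-- (b ∷ p) {suc i} {zero}  i≢j = cong (λ q → lookup q i) (p─⊥≡p p)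
lookup-- (b ∷ p) {suc i} {suc j} i≢j = lookup-- p (i≢j ∘ cong suc)

x∉p-x : ∀ {p : Subset n} {i} → i ∉ₛ p - i
x∉p-x {p = b ∷ p} {suc i} (there i∈) = x∉p-x i∈

x∈p-y⁻ : ∀ {p : Subset n} {i j} → i ∈ₛ p - j → i ≢ j × i ∈ₛ p
x∈p-y⁻ {p = b ∷ p} {zero}  {zero}  ()
x∈p-y⁻ {p = b ∷ p} {zero}  {suc j} here = (λ ()) , here
x∈p-y⁻ {p = b ∷ p} {suc i} {zero}  (there i∈) = (λ ()) , there (subst (i ∈ₛ_) (p─⊥≡p p) i∈)
x∈p-y⁻ {p = b ∷ p} {suc i} {suc j} (there i∈) with x∈p-y⁻ i∈
... | i≢j , i∈p = i≢j ∘ Fin.suc-injective , there i∈p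

x∈p∪⁅y⁆⁻ : ∀ (p : Subset n) {i j} → i ∈ₛ p ∪ ⁅ j ⁆ → i ≡ j ⊎ i ∈ₛ p
x∈p∪⁅y⁆⁻ p {j = j} i∈ with x∈p∪q⁻ p ⁅ j ⁆ i∈
... | inj₁ i∈p = inj₂ i∈p
... | inj₂ i∈j = inj₁ (x∈⁅y⁆⇒x≡y j i∈j)

updateAt-cases : ∀ {A : Set} {B : Subset n} {i j} (ν : Fin n → A) {f : A → A} → i ∉ₛ B → j ∈ₛ B ∪ ⁅ i ⁆ →
  (j ≡ i × updateAt ν i f j ≡ f (ν i)) ⊎ (j ∈ₛ B × updateAt ν i f j ≡ ν j)
updateAt-cases {B = B} {i} {j} ν i∉B j∈ with x∈p∪⁅y⁆⁻ B j∈
... | inj₁ refl = inj₁ (refl , updateAt-updates i ν)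
... | inj₂ j∈B  = inj₂ (j∈B , updateAt-minimal j i ν (λ { refl → i∉B j∈B }))

∣∷∣ : ∀ b (p : Subset n) → ∣ b ∷ p ∣ ≡ bit b + ∣ p ∣
∣∷∣ true  p = refl
∣∷∣ false p = refl

∣p∪q∣+∣p∩q∣ : ∀ (p q : Subset n) → ∣ p ∪ q ∣ + ∣ p ∩ q ∣ ≡ ∣ p ∣ + ∣ q ∣
∣p∪q∣+∣p∩q∣ []      []      = refl
∣p∪q∣+∣p∩q∣ (true  ∷ p) (true  ∷ q) =
  cong suc (trans (+-suc _ _) (trans (cong suc (∣p∪q∣+∣p∩q∣ p q)) (sym (+-suc _ _))))
∣p∪q∣+∣p∩q∣ (true  ∷ p) (false ∷ q) = cong suc (∣p∪q∣+∣p∩q∣ p q)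
∣p∪q∣+∣p∩q∣ (false ∷ p) (true  ∷ q) = trans (cong suc (∣p∪q∣+∣p∩q∣ p q)) (sym (+-suc _ _))
∣p∪q∣+∣p∩q∣ (false ∷ p) (false ∷ q) = ∣p∪q∣+∣p∩q∣ p q

∣p∪⁅x⁆∣ : ∀ (p : Subset n) {i} → i ∉ₛ p → ∣ p ∪ ⁅ i ⁆ ∣ ≡ suc ∣ p ∣
∣p∪⁅x⁆∣ (true  ∷ p) {zero}  i∉p = ⊥-elim (i∉p here)
∣p∪⁅x⁆∣ (false ∷ p) {zero}  i∉p = cong (suc ∘ ∣_∣) (∪-identityʳ p)
∣p∪⁅x⁆∣ (true  ∷ p) {suc i} i∉p = cong suc (∣p∪⁅x⁆∣ p (i∉p ∘ there))
∣p∪⁅x⁆∣ (false ∷ p) {suc i} i∉p = ∣p∪⁅x⁆∣ p (i∉p ∘ there)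

∣p∣≡∣p-x∣+bit : ∀ (p : Subset n) i → ∣ p ∣ ≡ ∣ p - i ∣ + bit (lookup p i)
∣p∣≡∣p-x∣+bit (true  ∷ p) zero    = trans (cong (suc ∘ ∣_∣) (sym (p─⊥≡p p))) (+-comm 1 _)
∣p∣≡∣p-x∣+bit (false ∷ p) zero    = trans (cong ∣_∣ (sym (p─⊥≡p p))) (sym (+-identityʳ _))
∣p∣≡∣p-x∣+bit (true  ∷ p) (suc i) = cong suc (∣p∣≡∣p-x∣+bit p i)
∣p∣≡∣p-x∣+bit (false ∷ p) (suc i) = ∣p∣≡∣p-x∣+bit p i

∣p[x]≔b∣ : ∀ (p : Subset n) {i} b → i ∉ₛ p → ∣ p [ i ]≔ b ∣ ≡ ∣ p ∣ + bit b
∣p[x]≔b∣ (true  ∷ p) {zero}  b     i∉p = ⊥-elim (i∉p here)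
∣p[x]≔b∣ (false ∷ p) {zero}  true  i∉p = +-comm 1 _
∣p[x]≔b∣ (false ∷ p) {zero}  false i∉p = sym (+-identityʳ _)
∣p[x]≔b∣ (true  ∷ p) {suc i} b     i∉p = cong suc (∣p[x]≔b∣ p b (i∉p ∘ there))
∣p[x]≔b∣ (false ∷ p) {suc i} b     i∉p = ∣p[x]≔b∣ p b (i∉p ∘ there)

elements : Subset n → List (Fin n)
elements p = filterᵇ (lookup p) (allFin _)

length-elements : ∀ (p : Subset n) → length (elements p) ≡ ∣ p ∣
length-elements p = trans (length-filterᵇ (lookup p) (allFin _)) (sym (∣p∣≡countᵇ p))
  where
  ∣p∣≡countᵇ : ∀ {n} (p : Subset n) → ∣ p ∣ ≡ countᵇ (lookup p) (allFin n)
  ∣p∣≡countᵇ []      = refl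
  ∣p∣≡countᵇ (b ∷ p) = begin
    ∣ b ∷ p ∣                                    ≡⟨ ∣∷∣ b p ⟩
    bit b + ∣ p ∣                                ≡⟨ cong (bit b +_) (∣p∣≡countᵇ p) ⟩
    bit b + countᵇ (lookup p) (allFin _)         ≡⟨ cong (bit b +_) (sym (countᵇ-map q suc (allFin _))) ⟩
    bit b + countᵇ q (map suc (allFin _))        ≡⟨ cong (λ xs → bit b + countᵇ q xs) (map-tabulate id suc) ⟩
    countᵇ q (allFin _)                          ∎
    where
    open ≡-Reasoning
    q : Fin (suc _) → Bool
    q = lookup (b ∷ p)

∈-elements⁺ : ∀ {p : Subset n} {i} → i ∈ₛ p → i ∈ elements p
∈-elements⁺ {p = p} {i} i∈p = ∈-filter⁺ (T? ∘ lookup p) (∈-allFin i) (≡true⇒T ([]=⇒lookup i∈p))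

∈-elements⁻ : ∀ {p : Subset n} {i} → i ∈ elements p → i ∈ₛ p
∈-elements⁻ {p = p} {i} i∈ = lookup⇒[]= i p (T⇒≡true (proj₂ (∈-filter⁻ (T? ∘ lookup p) {xs = allFin _} i∈)))

elements-Unique : ∀ (p : Subset n) → Unique (elements p)
elements-Unique p = Unique.filter⁺ (T? ∘ lookup p) (Unique.allFin⁺ _)

countᵇ-image : ∀ (S : Subset n) (ν : Fin n → ℕ) (q : ℕ → Bool) {V : List ℕ} → Unique V →
  (∀ {i j} → i ∈ₛ S → j ∈ₛ S → ν i ≡ ν j → i ≡ j) →
  (∀ {i} → i ∈ₛ S → ν i ∈ V × q (ν i) ≡ true) →
  (∀ {x} → x ∈ V → q x ≡ true → ∃ λ i → i ∈ₛ S × ν i ≡ x) →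
  countᵇ q V ≡ ∣ S ∣
countᵇ-image S ν q {V} V-unique ν-injective ν-into ν-onto = begin
  countᵇ q V                   ≡⟨ sym (length-filterᵇ q V) ⟩
  length (filterᵇ q V)         ≡⟨ ≤-antisym (Unique-length-≤ filter-unique filter⊆image)
                                            (Unique-length-≤ image-unique image⊆filter) ⟩
  length (map ν (elements S))  ≡⟨ length-map ν (elements S) ⟩
  length (elements S)          ≡⟨ length-elements S ⟩
  ∣ S ∣                        ∎
  where
  open ≡-Reasoning
  filter-unique : Unique (filterᵇ q V)
  filter-unique = Unique.filter⁺ (T? ∘ q) V-unique
  image-unique : Unique (map ν (elements S))
  image-unique = Unique-map⁺ (λ i∈ j∈ → ν-injective (∈-elements⁻ i∈) (∈-elements⁻ j∈)) (elements-Unique S)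
  filter⊆image : filterᵇ q V ⊆ map ν (elements S)
  filter⊆image x∈ with ∈-filter⁻ (T? ∘ q) {xs = V} x∈
  ... | x∈V , qx with ν-onto x∈V (T⇒≡true qx)
  ... | i , i∈S , refl = ∈-map⁺ ν (∈-elements⁺ i∈S)
  image⊆filter : map ν (elements S) ⊆ filterᵇ q V
  image⊆filter x∈ with ∈-map⁻ ν x∈
  ... | i , i∈ , refl with ν-into (∈-elements⁻ i∈)
  ... | νi∈V , qνi = ∈-filter⁺ (T? ∘ q) νi∈V (≡true⇒T qνi)

module _ {k : ℕ} where

  _≼_ : W k → W k → Set
  (R′ , s′) ≼ (R , s) = R′ ≡ R × s′ ≤ s

  Dominated : List (W k) → W k → Set
  Dominated S w = ∃ λ w′ → w′ ∈ S × w′ ≼ w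

  Clean-⊆ : ∀ (S : List (W k)) → Clean S ⊆ S
  Clean-⊆ S w∈ = proj₁ (∈-filter⁻ _ {xs = S} w∈)

  beaten-by : W k → W k → Bool
  beaten-by (R , s) (R′ , s′) = does (R′ ≟S R) ∧ (s′ <ᵇ s)

  Clean-dominates : ∀ (S : List (W k)) {w} → w ∈ S → Dominated (Clean S) w
  Clean-dominates S {R , s} = <-rec Goal step s
    where
    Goal : ℕ → Set
    Goal s = ∀ {R} → (R , s) ∈ S → Dominated (Clean S) (R , s)
    step : ∀ s → (∀ {s′} → s′ < s → Goal s′) → Goal s
    step s rec {R} w∈ with any (beaten-by (R , s)) S in eq
    ... | false = (R , s) , ∈-filter⁺ _ w∈ (≡true⇒T (cong not eq)) , refl , ≤-refl
    ... | true with find (any⁻ (beaten-by (R , s)) S (≡true⇒T eq))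
    ... | (R′ , s′) , w′∈ , beaten with R′ ≟S R
    ... | no _ = ⊥-elim beaten
    ... | yes refl with rec (<ᵇ⇒< s′ s beaten) w′∈
    ... | w′′ , w′′∈ , R′′≡R , s′′≤s′ = w′′ , w′′∈ , R′′≡R , ≤-trans s′′≤s′ (<⇒≤ (<ᵇ⇒< s′ s beaten))

  lift₁-dominates : ∀ (f : W k → List (W k)) S {w₀ w} → w₀ ∈ S → w ∈ f w₀ → Dominated (lift₁ f S) w
  lift₁-dominates f S w₀∈ w∈ = Clean-dominates (concatMap f S) (∈-concatMap⁺ f (lose w₀∈ w∈))

  lift₁-origin : ∀ (f : W k → List (W k)) S {w} → w ∈ lift₁ f S → ∃ λ w₀ → w₀ ∈ S × w ∈ f w₀
  lift₁-origin f S w∈ = find (∈-concatMap⁻ f {xs = S} (Clean-⊆ (concatMap f S) w∈))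

  lift₂-dominates : ∀ (f : W k → W k → List (W k)) S₁ S₂ {w₁ w₂ w} →
    w₁ ∈ S₁ → w₂ ∈ S₂ → w ∈ f w₁ w₂ → Dominated (lift₂ f S₁ S₂) w
  lift₂-dominates f S₁ S₂ w₁∈ w₂∈ w∈ =
    Clean-dominates _ (∈-concatMap⁺ _ (lose w₁∈ (∈-concatMap⁺ (f _) (lose w₂∈ w∈))))

  lift₂-origin : ∀ (f : W k → W k → List (W k)) S₁ S₂ {w} → w ∈ lift₂ f S₁ S₂ →
    ∃ λ w₁ → ∃ λ w₂ → w₁ ∈ S₁ × w₂ ∈ S₂ × w ∈ f w₁ w₂
  lift₂-origin f S₁ S₂ w∈ with find (∈-concatMap⁻ _ {xs = S₁} (Clean-⊆ _ w∈))
  ... | w₁ , w₁∈ , w∈′ with find (∈-concatMap⁻ (f w₁) {xs = S₂} w∈′)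
  ... | w₂ , w₂∈ , w∈′′ = w₁ , w₂ , w₁∈ , w₂∈ , w∈′′

  introEdgeW-covered : ∀ {u v : Fin (suc k)} {R s} → u ∈ₛ R ⊎ v ∈ₛ R → introEdgeW u v (R , s) ≡ (R , s) ∷ []
  introEdgeW-covered {u} {v} {R} covered with u ∈? R | v ∈? R
  ... | yes _  | _      = refl
  ... | no _   | yes _  = refl
  ... | no u∉R | no v∉R = ⊥-elim ([ u∉R , v∉R ]′ covered)

  introEdgeW-uncovered : ∀ {u v : Fin (suc k)} {R s} → u ∉ₛ R → v ∉ₛ R →
    introEdgeW u v (R , s) ≡ (R ∪ ⁅ u ⁆ , suc s) ∷ (R ∪ ⁅ v ⁆ , suc s) ∷ []
  introEdgeW-uncovered {u} {v} {R} u∉R v∉R with u ∈? R | v ∈? R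
  ... | yes u∈R | _       = ⊥-elim (u∉R u∈R)
  ... | no _    | yes v∈R = ⊥-elim (v∉R v∈R)
  ... | no _    | no _    = refl

lookupLab-just : ∀ {u x} as → lookupLab u as ≡ just x → (u , x) ∈ as
lookupLab-just {u} ((u′ , y) ∷ as) eq with u ≡ᵇ u′ in u≡ᵇu′
... | true  = here (cong₂ _,_ (≡ᵇ⇒≡ u u′ (≡true⇒T u≡ᵇu′)) (sym (just-injective eq)))
... | false = there (lookupLab-just as eq)

lookupLab-nothing : ∀ {u x} as → lookupLab u as ≡ nothing → (u , x) ∉ as
lookupLab-nothing {u} ((u′ , y) ∷ as) eq x∈ with u ≡ᵇ u′ in u≡ᵇu′ | eq | x∈
... | true  | ()  | _
... | false | _   | here refl  = subst T u≡ᵇu′ (≡⇒≡ᵇ u u refl)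
... | false | eq′ | there x∈′ = lookupLab-nothing as eq′ x∈′

labelOf≡lookupLab∘swap : ∀ x as → labelOf x as ≡ lookupLab x (map swap as)
labelOf≡lookupLab∘swap x []              = refl
labelOf≡lookupLab∘swap x ((u , y) ∷ as) =
  cong (λ m → if x ≡ᵇ y then just u else m) (labelOf≡lookupLab∘swap x as)

labelOf-just : ∀ {x u} as → labelOf x as ≡ just u → (u , x) ∈ as
labelOf-just {x} as eq
  with ∈-map⁻ swap (lookupLab-just (map swap as) (trans (sym (labelOf≡lookupLab∘swap x as)) eq))
... | _ , p∈ , refl = p∈

labelOf-nothing : ∀ {x u} as → labelOf x as ≡ nothing → (u , x) ∉ as
labelOf-nothing {x} as eq p∈ =
  lookupLab-nothing (map swap as) (trans (sym (labelOf≡lookupLab∘swap x as)) eq) (∈-map⁺ swap p∈)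

fresh-> : ∀ {x} xs → x ∈ xs → x < fresh xs
fresh-> (y ∷ xs) (here refl) = s≤s (m≤m⊔n y _)
fresh-> (y ∷ xs) (there x∈)  = ≤-trans (fresh-> xs x∈) (s≤s (m≤n⊔m y _))

fresh-∉ : ∀ xs → fresh xs ∉ xs
fresh-∉ xs fresh∈ = <-irrefl refl (fresh-> xs fresh∈)

label : ∀ {k} → Fin (suc k) → ℕ
label i = suc (toℕ i)

label-injective : ∀ {k} {i j : Fin (suc k)} → label i ≡ label j → i ≡ j
label-injective = Fin.toℕ-injective ∘ suc-injective

isActive : LGraph → ℕ → Bool
isActive G x = not (isNothing (labelOf x (act G)))

size : LGraph → (ℕ → Bool) → ℕ
size G P = countᵇ P (lV G)

Covers : LGraph → (ℕ → Bool) → Set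
Covers G P = ∀ {e} → e ∈ lE G → ∃ λ v → (e , v) ∈ lI G × P v ≡ true

Agrees : ∀ {k} → Subset (suc k) → (Fin (suc k) → ℕ) → (ℕ → Bool) → Subset (suc k) → Set
Agrees B ν P R = ∀ {i} → i ∈ₛ B → P (ν i) ≡ lookup R i

record WellFormed {k} (B : Subset (suc k)) (ν : Fin (suc k) → ℕ) (G : LGraph) : Set where
  field
    vertices-unique  : Unique (lV G)
    incidence-edge   : ∀ {e v} → (e , v) ∈ lI G → e ∈ lE G
    incidence-vertex : ∀ {e v} → (e , v) ∈ lI G → v ∈ lV G
    edge-incidence   : ∀ {e} → e ∈ lE G → ∃ λ v → (e , v) ∈ lI G
    active⇒bag       : ∀ {u x} → (u , x) ∈ act G → ∃ λ i → i ∈ₛ B × u ≡ label i × x ≡ ν i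
    bag⇒active       : ∀ {i} → i ∈ₛ B → (label i , ν i) ∈ act G
    bag-vertex       : ∀ {i} → i ∈ₛ B → ν i ∈ lV G
    bag-injective    : ∀ {i j} → i ∈ₛ B → j ∈ₛ B → ν i ≡ ν j → i ≡ j

  lookupLab-bag : ∀ {i} → i ∈ₛ B → lookupLab (label i) (act G) ≡ just (ν i)
  lookupLab-bag {i} i∈B with lookupLab (label i) (act G) in eq
  ... | nothing = ⊥-elim (lookupLab-nothing (act G) eq (bag⇒active i∈B))
  ... | just x with active⇒bag (lookupLab-just (act G) eq)
  ... | j , _ , i≡j , refl = cong (just ∘ ν) (sym (label-injective i≡j))

  labelOf-bag : ∀ {i} → i ∈ₛ B → labelOf (ν i) (act G) ≡ just (label i)
  labelOf-bag {i} i∈B with labelOf (ν i) (act G) in eq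
  ... | nothing = ⊥-elim (labelOf-nothing (act G) eq (bag⇒active i∈B))
  ... | just u with active⇒bag (labelOf-just (act G) eq)
  ... | j , j∈B , refl , νi≡νj = cong (just ∘ label) (sym (bag-injective i∈B j∈B νi≡νj))

  labelOf-active : ∀ {x u} → labelOf x (act G) ≡ just u → ∃ λ i → i ∈ₛ B × u ≡ label i × x ≡ ν i
  labelOf-active eq = active⇒bag (labelOf-just (act G) eq)

  isActive-bag : ∀ {i} → i ∈ₛ B → isActive G (ν i) ≡ true
  isActive-bag i∈B = cong (not ∘ isNothing) (labelOf-bag i∈B)

  isActive⇒bag : ∀ {x} → isActive G x ≡ true → ∃ λ i → i ∈ₛ B × ν i ≡ x
  isActive⇒bag {x} active with labelOf x (act G) in eq
  ... | just u with labelOf-active eq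
  ... | i , i∈B , _ , refl = i , i∈B , refl

  count-active : ∀ {P R} → R ⊆ₛ B → Agrees B ν P R → countᵇ (λ x → isActive G x ∧ P x) (lV G) ≡ ∣ R ∣
  count-active {P} {R} R⊆B agrees = countᵇ-image R ν _ vertices-unique
    (λ i∈R j∈R → bag-injective (R⊆B i∈R) (R⊆B j∈R))
    (λ {i} i∈R → bag-vertex (R⊆B i∈R) ,
                 trans (cong (_∧ P (ν i)) (isActive-bag (R⊆B i∈R))) (trans (agrees (R⊆B i∈R)) ([]=⇒lookup i∈R)))
    λ {x} _ q → let i , i∈B , νi≡x = isActive⇒bag (∧-conicalˡ _ _ q) in
      i , lookup⇒[]= i R (trans (sym (agrees i∈B)) (trans (cong P νi≡x) (∧-conicalʳ _ _ q))) , νi≡x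

  size-change : ∀ {P Q R S} → R ⊆ₛ B → S ⊆ₛ B → Agrees B ν P R → Agrees B ν Q S →
    (∀ {x} → x ∈ lV G → isActive G x ≡ false → P x ≡ Q x) →
    size G Q + ∣ R ∣ ≡ size G P + ∣ S ∣
  size-change {P} {Q} {R} {S} R⊆B S⊆B P~R Q~S P≡Q = begin
    size G Q + ∣ R ∣               ≡⟨ cong (_+ ∣ R ∣) (split Q S S⊆B Q~S) ⟩
    (∣ S ∣ + inactive Q) + ∣ R ∣   ≡⟨ cong (λ c → (∣ S ∣ + c) + ∣ R ∣) (countᵇ-cong (lV G) same-inactive) ⟩
    (∣ S ∣ + inactive P) + ∣ R ∣   ≡⟨ swap-outer (∣ S ∣) (inactive P) (∣ R ∣) ⟩
    (∣ R ∣ + inactive P) + ∣ S ∣   ≡⟨ cong (_+ ∣ S ∣) (sym (split P R R⊆B P~R)) ⟩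
    size G P + ∣ S ∣               ∎
    where
    open ≡-Reasoning
    swap-outer : ∀ a b c → (a + b) + c ≡ (c + b) + a
    swap-outer = solve-∀
    inactive : (ℕ → Bool) → ℕ
    inactive P = countᵇ (λ x → not (isActive G x) ∧ P x) (lV G)
    split : ∀ P R → R ⊆ₛ B → Agrees B ν P R → size G P ≡ ∣ R ∣ + inactive P
    split P R R⊆B P~R = trans (countᵇ-split (isActive G) P (lV G)) (cong (_+ inactive P) (count-active R⊆B P~R))
    same-inactive : ∀ {x} → x ∈ lV G → not (isActive G x) ∧ Q x ≡ not (isActive G x) ∧ P x
    same-inactive {x} x∈ with isActive G x in active
    ... | true  = refl
    ... | false = sym (P≡Q x∈ active)

withVertex : LGraph → ℕ → LGraph
withVertex G u = mkLG (fresh (lV G) ∷ lV G) (lE G) (lI G) ((u , fresh (lV G)) ∷ act G)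

withoutLabel : LGraph → ℕ → LGraph
withoutLabel G u = mkLG (lV G) (lE G) (lI G) (filterᵇ (λ p → not (proj₁ p ≡ᵇ u)) (act G))

withEdge : LGraph → ℕ → ℕ → LGraph
withEdge G x y = mkLG (lV G) (fresh (lE G) ∷ lE G) ((fresh (lE G) , x) ∷ (fresh (lE G) , y) ∷ lI G) (act G)

LG-IntroEdge : ∀ {u v x y} τ → lookupLab u (act (LG τ)) ≡ just x → lookupLab v (act (LG τ)) ≡ just y →
  LG (IntroEdge u v τ) ≡ withEdge (LG τ) x y
LG-IntroEdge τ u↦x v↦y rewrite u↦x | v↦y = refl

activeVertex : ∀ {k τ B} → Run k τ B → Fin (suc k) → ℕ
activeVertex leaf               = λ _ → 0
activeVertex (iv {τ = τ} l r _) = updateAt (activeVertex r) (idx l) (λ _ → fresh (lV (LG τ)))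
activeVertex (fv _ r _)         = activeVertex r
activeVertex (ie _ _ _ r _ _)   = activeVertex r
activeVertex (jn r _)           = activeVertex r

wellFormed-leaf : ∀ {k} → WellFormed {k} ⊥ (λ _ → 0) (LG Leaf)
wellFormed-leaf = record
  { vertices-unique  = []
  ; incidence-edge   = λ ()
  ; incidence-vertex = λ ()
  ; edge-incidence   = λ ()
  ; active⇒bag       = λ ()
  ; bag⇒active       = ⊥-elim ∘ ∉⊥
  ; bag-vertex       = ⊥-elim ∘ ∉⊥
  ; bag-injective    = λ i∈⊥ → ⊥-elim (∉⊥ i∈⊥)
  }

module _ {k} {B : Subset (suc k)} {ν : Fin (suc k) → ℕ} {G : LGraph} (wf : WellFormed B ν G) where
  open WellFormed wf

  wellFormed-introVertex : ∀ {i} → i ∉ₛ B →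
    WellFormed (B ∪ ⁅ i ⁆) (updateAt ν i (λ _ → fresh (lV G))) (withVertex G (label i))
  wellFormed-introVertex {i} i∉B = record
    { vertices-unique  = All.tabulate (λ y∈ x≡y → fresh-∉ (lV G) (subst (_∈ lV G) (sym x≡y) y∈))
                         ∷ vertices-unique
    ; incidence-edge   = incidence-edge
    ; incidence-vertex = there ∘ incidence-vertex
    ; edge-incidence   = edge-incidence
    ; active⇒bag       = active⇒bag′
    ; bag⇒active       = bag⇒active′
    ; bag-vertex       = bag-vertex′
    ; bag-injective    = bag-injective′
    }
    where
    x : ℕ
    x = fresh (lV G)
    ν′ : Fin (suc k) → ℕ
    ν′ = updateAt ν i (λ _ → x)
    ν′-old : ∀ {j} → j ∈ₛ B → ν′ j ≡ ν j
    ν′-old {j} j∈B = updateAt-minimal j i ν (λ { refl → i∉B j∈B })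
    bag-cases : ∀ {j} → j ∈ₛ B ∪ ⁅ i ⁆ → (j ≡ i × ν′ j ≡ x) ⊎ (j ∈ₛ B × ν′ j ≡ ν j)
    bag-cases = updateAt-cases ν i∉B
    active⇒bag′ : ∀ {u y} → (u , y) ∈ (label i , x) ∷ act G → ∃ λ j → j ∈ₛ B ∪ ⁅ i ⁆ × u ≡ label j × y ≡ ν′ j
    active⇒bag′ (here refl) = i , x∈p∪q⁺ (inj₂ (x∈⁅x⁆ i)) , refl , sym (updateAt-updates i ν)
    active⇒bag′ (there p) with active⇒bag p
    ... | j , j∈B , u≡ , refl = j , x∈p∪q⁺ (inj₁ j∈B) , u≡ , sym (ν′-old j∈B)
    bag⇒active′ : ∀ {j} → j ∈ₛ B ∪ ⁅ i ⁆ → (label j , ν′ j) ∈ (label i , x) ∷ act G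
    bag⇒active′ j∈ with bag-cases j∈
    ... | inj₁ (refl , ν′j≡x) rewrite ν′j≡x = here refl
    ... | inj₂ (j∈B , ν′j≡νj) rewrite ν′j≡νj = there (bag⇒active j∈B)
    bag-vertex′ : ∀ {j} → j ∈ₛ B ∪ ⁅ i ⁆ → ν′ j ∈ x ∷ lV G
    bag-vertex′ j∈ with bag-cases j∈
    ... | inj₁ (refl , ν′j≡x) rewrite ν′j≡x = here refl
    ... | inj₂ (j∈B , ν′j≡νj) rewrite ν′j≡νj = there (bag-vertex j∈B)
    bag-injective′ : ∀ {j j′} → j ∈ₛ B ∪ ⁅ i ⁆ → j′ ∈ₛ B ∪ ⁅ i ⁆ → ν′ j ≡ ν′ j′ → j ≡ j′
    bag-injective′ j∈ j′∈ eq with bag-cases j∈ | bag-cases j′∈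
    ... | inj₁ (refl , a) | inj₁ (refl , b) = refl
    ... | inj₁ (refl , a) | inj₂ (j′∈B , b) =
      ⊥-elim (fresh-∉ (lV G) (subst (_∈ lV G) (trans (sym b) (trans (sym eq) a)) (bag-vertex j′∈B)))
    ... | inj₂ (j∈B , a)  | inj₁ (refl , b) =
      ⊥-elim (fresh-∉ (lV G) (subst (_∈ lV G) (trans (sym a) (trans eq b)) (bag-vertex j∈B)))
    ... | inj₂ (j∈B , a)  | inj₂ (j′∈B , b) = bag-injective j∈B j′∈B (trans (sym a) (trans eq b))

  wellFormed-forgetVertex : ∀ i → WellFormed (B - i) ν (withoutLabel G (label i))
  wellFormed-forgetVertex i = record
    { vertices-unique  = vertices-unique
    ; incidence-edge   = incidence-edge
    ; incidence-vertex = incidence-vertex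
    ; edge-incidence   = edge-incidence
    ; active⇒bag       = active⇒bag′
    ; bag⇒active       = bag⇒active′
    ; bag-vertex       = bag-vertex ∘ proj₂ ∘ x∈p-y⁻
    ; bag-injective    = λ j∈ j′∈ → bag-injective (proj₂ (x∈p-y⁻ j∈)) (proj₂ (x∈p-y⁻ j′∈))
    }
    where
    kept : ℕ × ℕ → Bool
    kept p = not (proj₁ p ≡ᵇ label i)
    active⇒bag′ : ∀ {u y} → (u , y) ∈ filterᵇ kept (act G) → ∃ λ j → j ∈ₛ B - i × u ≡ label j × y ≡ ν j
    active⇒bag′ p∈ with ∈-filter⁻ (T? ∘ kept) {xs = act G} p∈
    ... | p∈act , p-kept with active⇒bag p∈act
    ... | j , j∈B , refl , y≡ = j , x∈p∧x≢y⇒x∈p-y j∈B (T-not-≡ᵇ⇒≢ {label j} p-kept ∘ cong label) , refl , y≡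
    bag⇒active′ : ∀ {j} → j ∈ₛ B - i → (label j , ν j) ∈ filterᵇ kept (act G)
    bag⇒active′ j∈ with x∈p-y⁻ j∈
    ... | j≢i , j∈B =
      ∈-filter⁺ (T? ∘ kept) (bag⇒active j∈B) (≡true⇒T (cong not (≢⇒≡ᵇ≡false (j≢i ∘ label-injective))))

  wellFormed-withEdge : ∀ {i j} → i ∈ₛ B → j ∈ₛ B → WellFormed B ν (withEdge G (ν i) (ν j))
  wellFormed-withEdge {i} i∈B j∈B = record
    { vertices-unique  = vertices-unique
    ; incidence-edge   = λ { (here refl) → here refl ; (there (here refl)) → here refl
                           ; (there (there p)) → there (incidence-edge p) }
    ; incidence-vertex = λ { (here refl) → bag-vertex i∈B ; (there (here refl)) → bag-vertex j∈B
                           ; (there (there p)) → incidence-vertex p }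
    ; edge-incidence   = λ { (here refl) → ν i , here refl
                           ; (there e∈) → let v , p = edge-incidence e∈ in v , there (there p) }
    ; active⇒bag       = active⇒bag
    ; bag⇒active       = bag⇒active
    ; bag-vertex       = bag-vertex
    ; bag-injective    = bag-injective
    }

rename : ℕ → Maybe ℕ → ℕ → ℕ
rename m (just w) x = w
rename m nothing  x = m + x

-- glueVertex is the renaming that joinLG applies to the vertices of its second operand.  The
-- function used there is local to joinLG, so equations with it are obtained by evaluating the
-- two lookups performed by glue.
glueVertex : LGraph → LGraph → ℕ → ℕ
glueVertex G₁ G₂ x = rename (fresh (lV G₁)) (glue G₁ G₂ x) x

unglued : LGraph → LGraph → ℕ → Bool
unglued G₁ G₂ x = isNothing (glue G₁ G₂ x)

module _ (G₁ G₂ : LGraph) where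

  glueVertex-unlabelled : ∀ {x} → labelOf x (act G₂) ≡ nothing → glueVertex G₁ G₂ x ≡ fresh (lV G₁) + x
  glueVertex-unlabelled x↦ rewrite x↦ = refl

  glueVertex-unmatched : ∀ {x u} → labelOf x (act G₂) ≡ just u → lookupLab u (act G₁) ≡ nothing →
    glueVertex G₁ G₂ x ≡ fresh (lV G₁) + x
  glueVertex-unmatched x↦ u↦ rewrite x↦ | u↦ = refl

  glueVertex-matched : ∀ {x u w} → labelOf x (act G₂) ≡ just u → lookupLab u (act G₁) ≡ just w →
    glueVertex G₁ G₂ x ≡ w
  glueVertex-matched x↦ u↦ rewrite x↦ | u↦ = refl

  glueVertex-glued : ∀ {x w} → glue G₁ G₂ x ≡ just w → glueVertex G₁ G₂ x ≡ w
  glueVertex-glued eq rewrite eq = refl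

  glueVertex-unglued : ∀ {x} → glue G₁ G₂ x ≡ nothing → glueVertex G₁ G₂ x ≡ fresh (lV G₁) + x
  glueVertex-unglued eq rewrite eq = refl

  ∈-joinIncidence⁻ : ∀ {e v} → (e , v) ∈ lI (joinLG G₁ G₂) → (e , v) ∈ lI G₁ ⊎
    ∃ λ e′ → ∃ λ v′ → (e′ , v′) ∈ lI G₂ × e ≡ fresh (lE G₁) + e′ × v ≡ glueVertex G₁ G₂ v′
  ∈-joinIncidence⁻ p with ∈-++⁻ (lI G₁) p
  ... | inj₁ p₁ = inj₁ p₁
  ... | inj₂ p₂ with ∈-map⁻ _ p₂
  ... | (e′ , v′) , p′ , eq with labelOf v′ (act G₂) in x↦ | eq
  ... | nothing | refl = inj₂ (e′ , v′ , p′ , refl , sym (glueVertex-unlabelled x↦))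
  ... | just u  | eq′ with lookupLab u (act G₁) in u↦ | eq′
  ... | nothing | refl = inj₂ (e′ , v′ , p′ , refl , sym (glueVertex-unmatched x↦ u↦))
  ... | just w  | refl = inj₂ (e′ , v′ , p′ , refl , sym (glueVertex-matched x↦ u↦))

  ∈-joinActive⁻ : ∀ {u x} → (u , x) ∈ act (joinLG G₁ G₂) → (u , x) ∈ act G₁ ⊎
    ∃ λ x′ → (u , x′) ∈ act G₂ × x ≡ glueVertex G₁ G₂ x′
  ∈-joinActive⁻ p with ∈-++⁻ (act G₁) p
  ... | inj₁ p₁ = inj₁ p₁
  ... | inj₂ p₂ with ∈-map⁻ _ p₂
  ... | (u′ , x′) , p′ , eq with labelOf x′ (act G₂) in x↦ | eq
  ... | nothing | refl = inj₂ (x′ , p′ , sym (glueVertex-unlabelled x↦))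
  ... | just u  | eq′ with lookupLab u (act G₁) in u↦ | eq′
  ... | nothing | refl = inj₂ (x′ , p′ , sym (glueVertex-unmatched x↦ u↦))
  ... | just w  | refl = inj₂ (x′ , p′ , sym (glueVertex-matched x↦ u↦))

  ∈-joinIncidence⁺ : ∀ {e v} → (e , v) ∈ lI G₂ → (fresh (lE G₁) + e , glueVertex G₁ G₂ v) ∈ lI (joinLG G₁ G₂)
  ∈-joinIncidence⁺ {e} {v} p with labelOf v (act G₂) | ∈-++-map⁺ {ys = lI (joinLG G₁ G₂)} (lI G₁) refl p
  ... | nothing | mem = mem
  ... | just u  | mem with lookupLab u (act G₁) | mem
  ... | nothing | mem′ = mem′
  ... | just w  | mem′ = mem′

module Join {k} {B : Subset (suc k)} {ν₁ ν₂ : Fin (suc k) → ℕ} {G₁ G₂ : LGraph}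
            (wf₁ : WellFormed B ν₁ G₁) (wf₂ : WellFormed B ν₂ G₂) where
  private
    module W₁ = WellFormed wf₁
    module W₂ = WellFormed wf₂

  glue-bag : ∀ {i} → i ∈ₛ B → glue G₁ G₂ (ν₂ i) ≡ just (ν₁ i)
  glue-bag i∈B rewrite W₂.labelOf-bag i∈B = W₁.lookupLab-bag i∈B

  glueVertex-bag : ∀ {i} → i ∈ₛ B → glueVertex G₁ G₂ (ν₂ i) ≡ ν₁ i
  glueVertex-bag i∈B = glueVertex-glued G₁ G₂ (glue-bag i∈B)

  glue-just : ∀ {x w} → glue G₁ G₂ x ≡ just w → ∃ λ i → i ∈ₛ B × x ≡ ν₂ i × w ≡ ν₁ i
  glue-just {x} eq with labelOf x (act G₂) in x↦
  ... | just u with W₂.labelOf-active x↦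
  ... | i , i∈B , refl , refl rewrite W₁.lookupLab-bag i∈B with eq
  ... | refl = i , i∈B , refl , refl

  unglued≡inactive : ∀ x → unglued G₁ G₂ x ≡ not (isActive G₂ x)
  unglued≡inactive x with labelOf x (act G₂) in x↦
  ... | nothing = refl
  ... | just u with W₂.labelOf-active x↦
  ... | i , i∈B , refl , _ rewrite W₁.lookupLab-bag i∈B = refl

  glueVertex-vertex : ∀ {x} → x ∈ lV G₂ → glueVertex G₁ G₂ x ∈ lV (joinLG G₁ G₂)
  glueVertex-vertex {x} x∈ with glue G₁ G₂ x in eq
  ... | just w with glue-just eq
  ... | i , i∈B , _ , refl = ∈-++⁺ˡ (W₁.bag-vertex i∈B)
  glueVertex-vertex {x} x∈ | nothing =
    ∈-++⁺ʳ (lV G₁) (∈-map⁺ (fresh (lV G₁) +_) (∈-filter⁺ (T? ∘ unglued G₁ G₂) x∈ (≡true⇒T (cong isNothing eq))))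

  size-join : ∀ P → size (joinLG G₁ G₂) P ≡
    size G₁ P + countᵇ (λ x → not (isActive G₂ x) ∧ P (fresh (lV G₁) + x)) (lV G₂)
  size-join P = begin
    countᵇ P (lV G₁ ++ map (m +_) (filterᵇ (unglued G₁ G₂) (lV G₂)))
      ≡⟨ countᵇ-++ P (lV G₁) _ ⟩
    size G₁ P + countᵇ P (map (m +_) (filterᵇ (unglued G₁ G₂) (lV G₂)))
      ≡⟨ cong (size G₁ P +_) (countᵇ-map P (m +_) (filterᵇ (unglued G₁ G₂) (lV G₂))) ⟩
    size G₁ P + countᵇ (λ x → P (m + x)) (filterᵇ (unglued G₁ G₂) (lV G₂))
      ≡⟨ cong (size G₁ P +_) (countᵇ-filterᵇ _ (unglued G₁ G₂) (lV G₂)) ⟩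
    size G₁ P + countᵇ (λ x → unglued G₁ G₂ x ∧ P (m + x)) (lV G₂)
      ≡⟨ cong (size G₁ P +_) (countᵇ-cong (lV G₂) (λ {x} _ → cong (_∧ P (m + x)) (unglued≡inactive x))) ⟩
    size G₁ P + countᵇ (λ x → not (isActive G₂ x) ∧ P (m + x)) (lV G₂) ∎
    where
    open ≡-Reasoning
    m : ℕ
    m = fresh (lV G₁)

  Covers-joinˡ : ∀ {P} → Covers (joinLG G₁ G₂) P → Covers G₁ P
  Covers-joinˡ covers e∈ with covers (∈-++⁺ˡ e∈)
  ... | v , p , Pv with ∈-joinIncidence⁻ G₁ G₂ p
  ...   | inj₁ p₁ = v , p₁ , Pv
  ...   | inj₂ (e′ , _ , _ , refl , _) = ⊥-elim (<⇒≱ (fresh-> (lE G₁) e∈) (m≤m+n _ e′))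

  Covers-joinʳ : ∀ {P} → Covers (joinLG G₁ G₂) P → Covers G₂ (P ∘ glueVertex G₁ G₂)
  Covers-joinʳ covers {e} e∈ with covers (∈-++⁺ʳ (lE G₁) (∈-map⁺ (fresh (lE G₁) +_) e∈))
  ... | v , p , Pv with ∈-joinIncidence⁻ G₁ G₂ p
  ...   | inj₁ p₁ = ⊥-elim (<⇒≱ (fresh-> (lE G₁) (W₁.incidence-edge p₁)) (m≤m+n _ e))
  ...   | inj₂ (e′ , v′ , p₂ , e₀+e≡e₀+e′ , refl)
    rewrite +-cancelˡ-≡ (fresh (lE G₁)) e e′ e₀+e≡e₀+e′ = v′ , p₂ , Pv

  Agrees-joinʳ : ∀ {P A} → Agrees B ν₁ P A → Agrees B ν₂ (P ∘ glueVertex G₁ G₂) A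
  Agrees-joinʳ {P} agrees i∈B = trans (cong P (glueVertex-bag i∈B)) (agrees i∈B)

  size-join-split : ∀ {P A} → A ⊆ₛ B → Agrees B ν₁ P A →
    size (joinLG G₁ G₂) P + ∣ A ∣ ≡ size G₁ P + size G₂ (P ∘ glueVertex G₁ G₂)
  size-join-split {P} {A} A⊆B agrees = begin
    size (joinLG G₁ G₂) P + ∣ A ∣
      ≡⟨ cong (_+ ∣ A ∣) (trans (size-join P)
                                (cong (size G₁ P +_) (countᵇ-cong (lV G₂) λ {x} _ → unglued-cover x))) ⟩
    (size G₁ P + inactive₂) + ∣ A ∣
      ≡⟨ trans (+-assoc (size G₁ P) _ _) (cong (size G₁ P +_) (+-comm inactive₂ _)) ⟩
    size G₁ P + (∣ A ∣ + inactive₂)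
      ≡⟨ cong (size G₁ P +_) (sym (trans (countᵇ-split (isActive G₂) P₂ (lV G₂))
                                         (cong (_+ inactive₂) (W₂.count-active A⊆B (Agrees-joinʳ {P} {A} agrees))))) ⟩
    size G₁ P + size G₂ P₂ ∎
    where
    open ≡-Reasoning
    P₂ : ℕ → Bool
    P₂ = P ∘ glueVertex G₁ G₂
    inactive₂ : ℕ
    inactive₂ = countᵇ (λ x → not (isActive G₂ x) ∧ P₂ x) (lV G₂)
    unglued-cover : ∀ x → not (isActive G₂ x) ∧ P (fresh (lV G₁) + x) ≡ not (isActive G₂ x) ∧ P₂ x
    unglued-cover x with isActive G₂ x in active
    ... | true  = refl
    ... | false =
      cong P (sym (glueVertex-unglued G₁ G₂ (isNothing-true (trans (unglued≡inactive x) (cong not active)))))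

  wellFormed-join : WellFormed B ν₁ (joinLG G₁ G₂)
  wellFormed-join = record
    { vertices-unique  = Unique.++⁺ W₁.vertices-unique
                           (Unique.map⁺ (+-cancelˡ-≡ (fresh (lV G₁)) _ _) (Unique.filter⁺ _ W₂.vertices-unique))
                           disjoint
    ; incidence-edge   = incidence-edge
    ; incidence-vertex = incidence-vertex
    ; edge-incidence   = edge-incidence
    ; active⇒bag       = active⇒bag
    ; bag⇒active       = ∈-++⁺ˡ ∘ W₁.bag⇒active
    ; bag-vertex       = ∈-++⁺ˡ ∘ W₁.bag-vertex
    ; bag-injective    = W₁.bag-injective
    }
    where
    disjoint : ∀ {v} → ¬ (v ∈ lV G₁ × v ∈ map (fresh (lV G₁) +_) (filterᵇ (unglued G₁ G₂) (lV G₂)))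
    disjoint (v∈₁ , v∈₂) with ∈-map⁻ _ v∈₂
    ... | y , _ , refl = <⇒≱ (fresh-> (lV G₁) v∈₁) (m≤m+n _ y)
    incidence-edge : ∀ {e v} → (e , v) ∈ lI (joinLG G₁ G₂) → e ∈ lE (joinLG G₁ G₂)
    incidence-edge p with ∈-joinIncidence⁻ G₁ G₂ p
    ... | inj₁ p₁ = ∈-++⁺ˡ (W₁.incidence-edge p₁)
    ... | inj₂ (_ , _ , p₂ , refl , _) = ∈-++⁺ʳ (lE G₁) (∈-map⁺ _ (W₂.incidence-edge p₂))
    incidence-vertex : ∀ {e v} → (e , v) ∈ lI (joinLG G₁ G₂) → v ∈ lV (joinLG G₁ G₂)
    incidence-vertex p with ∈-joinIncidence⁻ G₁ G₂ p
    ... | inj₁ p₁ = ∈-++⁺ˡ (W₁.incidence-vertex p₁)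
    ... | inj₂ (_ , _ , p₂ , _ , refl) = glueVertex-vertex (W₂.incidence-vertex p₂)
    edge-incidence : ∀ {e} → e ∈ lE (joinLG G₁ G₂) → ∃ λ v → (e , v) ∈ lI (joinLG G₁ G₂)
    edge-incidence e∈ with ∈-++⁻ (lE G₁) e∈
    ... | inj₁ e∈₁ = let v , p = W₁.edge-incidence e∈₁ in v , ∈-++⁺ˡ p
    ... | inj₂ e∈₂ with ∈-map⁻ _ e∈₂
    ... | e′ , e′∈ , refl = let v , p = W₂.edge-incidence e′∈ in glueVertex G₁ G₂ v , ∈-joinIncidence⁺ G₁ G₂ p
    active⇒bag : ∀ {u x} → (u , x) ∈ act (joinLG G₁ G₂) → ∃ λ i → i ∈ₛ B × u ≡ label i × x ≡ ν₁ i
    active⇒bag p with ∈-joinActive⁻ G₁ G₂ p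
    ... | inj₁ p₁ = W₁.active⇒bag p₁
    ... | inj₂ (_ , p₂ , refl) with W₂.active⇒bag p₂
    ... | i , i∈B , u≡ , refl = i , i∈B , u≡ , glueVertex-bag i∈B

wellFormed : ∀ {k τ B} (r : Run k τ B) → WellFormed B (activeVertex r) (LG τ)
wellFormed leaf                = wellFormed-leaf
wellFormed (iv (lab i) r i∉B)  = wellFormed-introVertex (wellFormed r) i∉B
wellFormed (fv (lab i) r _)    = wellFormed-forgetVertex (wellFormed r) i
wellFormed (ie {τ = τ} (lab i) (lab j) _ r i∈B j∈B) =
  subst (WellFormed _ _) (sym (LG-IntroEdge τ (lookupLab-bag i∈B) (lookupLab-bag j∈B)))
        (wellFormed-withEdge (wellFormed r) i∈B j∈B)
  where open WellFormed (wellFormed r)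
wellFormed (jn r s)            = Join.wellFormed-join (wellFormed r) (wellFormed s)

-- Soundness of the table

record Realised {k} (B : Subset (suc k)) (ν : Fin (suc k) → ℕ) (G : LGraph) (R : Subset (suc k)) (s : ℕ)
  : Set where
  field
    R⊆B    : R ⊆ₛ B
    cover  : ℕ → Bool
    covers : Covers G cover
    size≤  : size G cover ≤ s
    agrees : Agrees B ν cover R

Sound : ∀ {k} → Subset (suc k) → (Fin (suc k) → ℕ) → LGraph → List (W k) → Set
Sound B ν G S = ∀ {R s} → (R , s) ∈ S → Realised B ν G R s

sound-leaf : ∀ {k} → Sound {k} ⊥ (λ _ → 0) (LG Leaf) ((⊥ , 0) ∷ [])
sound-leaf (here refl) = record
  { R⊆B = λ i∈⊥ → i∈⊥ ; cover = λ _ → false ; covers = λ () ; size≤ = z≤n ; agrees = ⊥-elim ∘ ∉⊥ }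

module _ {k} {B : Subset (suc k)} {ν : Fin (suc k) → ℕ} {G : LGraph} (wf : WellFormed B ν G) where
  open WellFormed wf

  realised-∣R∣≤s : ∀ {R s} → Realised B ν G R s → ∣ R ∣ ≤ s
  realised-∣R∣≤s {R} {s} ρ = begin
    ∣ R ∣                                                    ≡⟨ sym (count-active R⊆B agrees) ⟩
    countᵇ (λ x → isActive G x ∧ cover x) (lV G)             ≤⟨ m≤m+n _ _ ⟩
    countᵇ (λ x → isActive G x ∧ cover x) (lV G) +
      countᵇ (λ x → not (isActive G x) ∧ cover x) (lV G)     ≡⟨ sym (countᵇ-split (isActive G) cover (lV G)) ⟩
    size G cover                                             ≤⟨ size≤ ⟩
    s                                                        ∎
    where
    open Realised ρ
    open ≤-Reasoning

  sound-introVertex : ∀ {i S} → i ∉ₛ B → Sound B ν G S →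
    Sound (B ∪ ⁅ i ⁆) (updateAt ν i (λ _ → fresh (lV G))) (withVertex G (label i)) (lift₁ (λ w → w ∷ []) S)
  sound-introVertex {i} {S} i∉B sound w∈ with lift₁-origin _ S w∈
  ... | (R , s) , w₀∈ , here refl = record
    { R⊆B    = x∈p∪q⁺ ∘ inj₁ ∘ R⊆B
    ; cover  = cover′
    ; covers = λ e∈ → let v , p , cv = covers e∈ in v , p , trans (cover′-old (incidence-vertex p)) cv
    ; size≤  = subst (_≤ s) (sym (cong₂ _+_ (cong bit cover′-new) (countᵇ-cong (lV G) cover′-old))) size≤
    ; agrees = agrees′
    }
    where
    open Realised (sound w₀∈)
    x : ℕ
    x = fresh (lV G)
    -- cover is arbitrary outside lV G, so it may hold at the new vertex x.
    cover′ : ℕ → Bool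
    cover′ z = not (z ≡ᵇ x) ∧ cover z
    cover′-new : cover′ x ≡ false
    cover′-new = cong (λ b → not b ∧ cover x) (T⇒≡true (≡⇒≡ᵇ x x refl))
    cover′-old : ∀ {z} → z ∈ lV G → cover′ z ≡ cover z
    cover′-old {z} z∈ = cong (λ b → not b ∧ cover z) (≢⇒≡ᵇ≡false {z} {x} λ { refl → fresh-∉ (lV G) z∈ })
    agrees′ : Agrees (B ∪ ⁅ i ⁆) (updateAt ν i (λ _ → x)) cover′ R
    agrees′ j∈ with updateAt-cases ν i∉B j∈
    ... | inj₁ (refl , ν′i≡x) = trans (cong cover′ ν′i≡x) (trans cover′-new (sym (lookup-∉ (i∉B ∘ R⊆B))))
    ... | inj₂ (j∈B , ν′j≡νj) = trans (cong cover′ ν′j≡νj) (trans (cover′-old (bag-vertex j∈B)) (agrees j∈B))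

  sound-forgetVertex : ∀ {i S} → Sound B ν G S →
    Sound (B - i) ν (withoutLabel G (label i)) (lift₁ (λ w → (proj₁ w - i , proj₂ w) ∷ []) S)
  sound-forgetVertex {i} {S} sound w∈ with lift₁-origin _ S w∈
  ... | (R , s) , w₀∈ , here refl = record
    { R⊆B    = λ j∈ → let j≢i , j∈R = x∈p-y⁻ j∈ in x∈p∧x≢y⇒x∈p-y (R⊆B j∈R) j≢i
    ; cover  = cover
    ; covers = covers
    ; size≤  = size≤
    ; agrees = λ j∈ → let j≢i , j∈B = x∈p-y⁻ j∈ in trans (agrees j∈B) (sym (lookup-- R j≢i))
    }
    where open Realised (sound w₀∈)

  realised-withEdge : ∀ {i j R s} → i ∈ₛ R ⊎ j ∈ₛ R → Realised B ν G R s →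
    Realised B ν (withEdge G (ν i) (ν j)) R s
  realised-withEdge {i} {j} {R} {s} i∨j∈R ρ = record
    { R⊆B = R⊆B ; cover = cover ; covers = covers′ ; size≤ = size≤ ; agrees = agrees }
    where
    open Realised ρ
    covers′ : Covers (withEdge G (ν i) (ν j)) cover
    covers′ (here refl) =
      [ (λ i∈R → ν i , here refl , trans (agrees (R⊆B i∈R)) ([]=⇒lookup i∈R))
      , (λ j∈R → ν j , there (here refl) , trans (agrees (R⊆B j∈R)) ([]=⇒lookup j∈R)) ]′ i∨j∈R
    covers′ (there e∈) = let v , p , cv = covers e∈ in v , there (there p) , cv

  realised-withEdge-∪ : ∀ {i j u R s} → u ∈ₛ B → u ∉ₛ R →
    (fresh (lE G) , ν u) ∈ lI (withEdge G (ν i) (ν j)) → Realised B ν G R s →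
    Realised B ν (withEdge G (ν i) (ν j)) (R ∪ ⁅ u ⁆) (suc s)
  realised-withEdge-∪ {i} {j} {u} {R} {s} u∈B u∉R new-incidence ρ = record
    { R⊆B = R∪u⊆B ; cover = cover′ ; covers = covers′ ; size≤ = size≤′ ; agrees = agrees′ }
    where
    open Realised ρ
    cover′ : ℕ → Bool
    cover′ z = cover z ∨ (z ≡ᵇ ν u)
    R∪u⊆B : R ∪ ⁅ u ⁆ ⊆ₛ B
    R∪u⊆B x∈ with x∈p∪⁅y⁆⁻ R x∈
    ... | inj₁ refl = u∈B
    ... | inj₂ x∈R  = R⊆B x∈R
    covers′ : Covers (withEdge G (ν i) (ν j)) cover′
    covers′ (here refl) = ν u , new-incidence , trans (cong (cover (ν u) ∨_) (≡ᵇ-refl (ν u))) (∨-zeroʳ _)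
    covers′ (there e∈)  = let v , p , cv = covers e∈ in v , there (there p) , cong (_∨ (v ≡ᵇ ν u)) cv
    agrees′ : Agrees B ν cover′ (R ∪ ⁅ u ⁆)
    agrees′ {j} j∈B = trans (cong₂ _∨_ (agrees j∈B) is-u) (sym (lookup-zipWith _∨_ j R ⁅ u ⁆))
      where
      is-u : (ν j ≡ᵇ ν u) ≡ lookup ⁅ u ⁆ j
      is-u with j Fin.≟ u
      ... | yes refl = trans (≡ᵇ-refl (ν u)) (sym ([]=⇒lookup (x∈⁅x⁆ u)))
      ... | no j≢u   = trans (≢⇒≡ᵇ≡false (j≢u ∘ bag-injective j∈B u∈B)) (sym (lookup-∉ (x≢y⇒x∉⁅y⁆ j≢u)))
    size-grows : size G cover′ ≡ suc (size G cover)
    size-grows = +-cancelʳ-≡ _ _ _ (begin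
      size G cover′ + ∣ R ∣             ≡⟨ size-change R⊆B R∪u⊆B agrees agrees′ same-off-bag ⟩
      size G cover + ∣ R ∪ ⁅ u ⁆ ∣      ≡⟨ cong (size G cover +_) (∣p∪⁅x⁆∣ R u∉R) ⟩
      size G cover + suc ∣ R ∣          ≡⟨ +-suc _ _ ⟩
      suc (size G cover) + ∣ R ∣        ∎)
      where
      open ≡-Reasoning
      same-off-bag : ∀ {x} → x ∈ lV G → isActive G x ≡ false → cover x ≡ cover′ x
      same-off-bag {x} _ inactive = sym (trans (cong (cover x ∨_) (≢⇒≡ᵇ≡false x≢νu)) (∨-identityʳ _))
        where
        x≢νu : x ≢ ν u
        x≢νu refl with () ← trans (sym inactive) (isActive-bag u∈B)
    size≤′ : size G cover′ ≤ suc s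
    size≤′ = subst (_≤ suc s) (sym size-grows) (s≤s size≤)

  sound-introEdge : ∀ {i j S} → i ∈ₛ B → j ∈ₛ B → Sound B ν G S →
    Sound B ν (withEdge G (ν i) (ν j)) (lift₁ (introEdgeW i j) S)
  sound-introEdge {i} {j} {S} i∈B j∈B sound w∈ with lift₁-origin _ S w∈
  ... | (R , s) , w₀∈ , w∈step with i ∈? R | j ∈? R | w∈step
  ... | yes i∈R | _       | here refl         = realised-withEdge (inj₁ i∈R) (sound w₀∈)
  ... | no _    | yes j∈R | here refl         = realised-withEdge (inj₂ j∈R) (sound w₀∈)
  ... | no i∉R  | no j∉R  | here refl         = realised-withEdge-∪ i∈B i∉R (here refl) (sound w₀∈)
  ... | no i∉R  | no j∉R  | there (here refl) = realised-withEdge-∪ j∈B j∉R (there (here refl)) (sound w₀∈)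

join-size-arith : ∀ {q y i r₁ r₂ c₁ c₂ u} → q + r₁ ≡ c₁ + u → u + i ≡ r₁ + r₂ → c₂ ≡ r₂ + y →
  (q + y) + i ≡ c₁ + c₂
join-size-arith {q} {y} {i} {r₁} {r₂} {c₁} {c₂} {u} e₁ e₂ e₃ = +-cancelʳ-≡ r₁ _ _ (begin
  ((q + y) + i) + r₁     ≡⟨ rearrange₁ q y i r₁ ⟩
  (q + r₁) + (y + i)     ≡⟨ cong (_+ (y + i)) e₁ ⟩
  (c₁ + u) + (y + i)     ≡⟨ rearrange₂ c₁ u y i ⟩
  (c₁ + y) + (u + i)     ≡⟨ cong ((c₁ + y) +_) e₂ ⟩
  (c₁ + y) + (r₁ + r₂)   ≡⟨ rearrange₃ c₁ y r₁ r₂ ⟩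
  (c₁ + (r₂ + y)) + r₁   ≡⟨ cong (λ c → (c₁ + c) + r₁) (sym e₃) ⟩
  (c₁ + c₂) + r₁         ∎)
  where
  open ≡-Reasoning
  rearrange₁ : ∀ a b c d → ((a + b) + c) + d ≡ (a + d) + (b + c)
  rearrange₁ = solve-∀
  rearrange₂ : ∀ a b c d → (a + b) + (c + d) ≡ (a + c) + (b + d)
  rearrange₂ = solve-∀
  rearrange₃ : ∀ a b c d → (a + b) + (c + d) ≡ (a + (d + b)) + c
  rearrange₃ = solve-∀

module _ {k} {B : Subset (suc k)} {ν₁ ν₂ : Fin (suc k) → ℕ} {G₁ G₂ : LGraph}
         (wf₁ : WellFormed B ν₁ G₁) (wf₂ : WellFormed B ν₂ G₂) where
  open Join wf₁ wf₂
  private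
    module W₁ = WellFormed wf₁
    module W₂ = WellFormed wf₂

  module JoinCover {R₁ s₁ R₂ s₂} (ρ₁ : Realised B ν₁ G₁ R₁ s₁) (ρ₂ : Realised B ν₂ G₂ R₂ s₂) where
    private
      module ρ₁ = Realised ρ₁
      module ρ₂ = Realised ρ₂
      m : ℕ
      m = fresh (lV G₁)

    transferred : ℕ → Bool
    transferred z with labelOf z (act G₁)
    ... | nothing = false
    ... | just u with lookupLab u (act G₂)
    ...   | nothing = false
    ...   | just y  = ρ₂.cover y

    transferred-bag : ∀ {i} → i ∈ₛ B → transferred (ν₁ i) ≡ lookup R₂ i
    transferred-bag i∈B rewrite W₁.labelOf-bag i∈B | W₂.lookupLab-bag i∈B = ρ₂.agrees i∈B

    transferred-inactive : ∀ {z} → isActive G₁ z ≡ false → transferred z ≡ false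
    transferred-inactive {z} inactive with labelOf z (act G₁) | inactive
    ... | nothing | _ = refl

    -- The vertices of G₁ are exactly those below m; the others are the renamed copies m + x of G₂.
    cover : ℕ → Bool
    cover z = if z <ᵇ m then ρ₁.cover z ∨ transferred z else ρ₂.cover (z ∸ m)

    cover-old : ∀ {z} → z ∈ lV G₁ → cover z ≡ ρ₁.cover z ∨ transferred z
    cover-old z∈ rewrite T⇒≡true (<⇒<ᵇ (fresh-> (lV G₁) z∈)) = refl

    cover-new : ∀ y → cover (m + y) ≡ ρ₂.cover y
    cover-new y with (m + y) <ᵇ m in lt
    ... | true  = ⊥-elim (<⇒≱ (<ᵇ⇒< _ _ (≡true⇒T lt)) (m≤m+n m y))
    ... | false = cong ρ₂.cover (m+n∸m≡n m y)

    cover-glued : ∀ {v} → ρ₂.cover v ≡ true → cover (glueVertex G₁ G₂ v) ≡ true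
    cover-glued {v} cv with glue G₁ G₂ v in eq
    ... | just w with glue-just eq
    ... | i , i∈B , refl , refl =
      trans (cover-old (W₁.bag-vertex i∈B))
            (trans (cong (ρ₁.cover (ν₁ i) ∨_) (trans (transferred-bag i∈B) (trans (sym (ρ₂.agrees i∈B)) cv)))
                   (∨-zeroʳ _))
    cover-glued {v} cv | nothing = trans (cover-new v) cv

    covers : Covers (joinLG G₁ G₂) cover
    covers e∈ with ∈-++⁻ (lE G₁) e∈
    ... | inj₁ e∈₁ = let v , p , cv = ρ₁.covers e∈₁ in
      v , ∈-++⁺ˡ p , trans (cover-old (W₁.incidence-vertex p)) (cong (_∨ transferred v) cv)
    ... | inj₂ e∈₂ with ∈-map⁻ _ e∈₂
    ... | e′ , e′∈ , refl = let v , p , cv = ρ₂.covers e′∈ in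
      glueVertex G₁ G₂ v , ∈-joinIncidence⁺ G₁ G₂ p , cover-glued cv

    agrees-∪ : Agrees B ν₁ (λ z → ρ₁.cover z ∨ transferred z) (R₁ ∪ R₂)
    agrees-∪ {i} i∈B =
      trans (cong₂ _∨_ (ρ₁.agrees i∈B) (transferred-bag i∈B)) (sym (lookup-zipWith _∨_ i R₁ R₂))

    agrees : Agrees B ν₁ cover (R₁ ∪ R₂)
    agrees i∈B = trans (cover-old (W₁.bag-vertex i∈B)) (agrees-∪ i∈B)

    R₁∪R₂⊆B : R₁ ∪ R₂ ⊆ₛ B
    R₁∪R₂⊆B = [ ρ₁.R⊆B , ρ₂.R⊆B ]′ ∘ x∈p∪q⁻ R₁ R₂

    size+∣R₁∩R₂∣ : size (joinLG G₁ G₂) cover + ∣ R₁ ∩ R₂ ∣ ≡ size G₁ ρ₁.cover + size G₂ ρ₂.cover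
    size+∣R₁∩R₂∣ = begin
      size (joinLG G₁ G₂) cover + ∣ R₁ ∩ R₂ ∣
        ≡⟨ cong (_+ ∣ R₁ ∩ R₂ ∣) (size-join cover) ⟩
      (size G₁ cover + countᵇ (λ x → not (isActive G₂ x) ∧ cover (m + x)) (lV G₂)) + ∣ R₁ ∩ R₂ ∣
        ≡⟨ cong (λ c → (size G₁ cover + c) + ∣ R₁ ∩ R₂ ∣)
                (countᵇ-cong (lV G₂) λ {x} _ → cong (not (isActive G₂ x) ∧_) (cover-new x)) ⟩
      (size G₁ cover + inactive₂) + ∣ R₁ ∩ R₂ ∣
        ≡⟨ join-size-arith {y = inactive₂} {r₂ = ∣ R₂ ∣}
             (trans (cong (_+ ∣ R₁ ∣) (countᵇ-cong (lV G₁) cover-old)) on-G₁) (∣p∪q∣+∣p∩q∣ R₁ R₂) on-G₂ ⟩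
      size G₁ ρ₁.cover + size G₂ ρ₂.cover ∎
      where
      open ≡-Reasoning
      inactive₂ : ℕ
      inactive₂ = countᵇ (λ x → not (isActive G₂ x) ∧ ρ₂.cover x) (lV G₂)
      on-G₁ : size G₁ (λ z → ρ₁.cover z ∨ transferred z) + ∣ R₁ ∣ ≡ size G₁ ρ₁.cover + ∣ R₁ ∪ R₂ ∣
      on-G₁ = W₁.size-change ρ₁.R⊆B R₁∪R₂⊆B ρ₁.agrees agrees-∪
        (λ _ inactive → sym (trans (cong (_ ∨_) (transferred-inactive inactive)) (∨-identityʳ _)))
      on-G₂ : size G₂ ρ₂.cover ≡ ∣ R₂ ∣ + inactive₂
      on-G₂ = trans (countᵇ-split (isActive G₂) ρ₂.cover (lV G₂))
                    (cong (_+ inactive₂) (W₂.count-active ρ₂.R⊆B ρ₂.agrees))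

  realised-join : ∀ {R₁ s₁ R₂ s₂} → Realised B ν₁ G₁ R₁ s₁ → Realised B ν₂ G₂ R₂ s₂ →
    Realised B ν₁ (joinLG G₁ G₂) (R₁ ∪ R₂) (s₁ + s₂ ∸ ∣ R₁ ∩ R₂ ∣)
  realised-join {R₁} {s₁} {R₂} {s₂} ρ₁ ρ₂ = record
    { R⊆B    = R₁∪R₂⊆B
    ; cover  = cover
    ; covers = covers
    ; size≤  = m+n≤o⇒m≤o∸n _ (subst (_≤ s₁ + s₂) (sym size+∣R₁∩R₂∣)
                                   (+-mono-≤ (Realised.size≤ ρ₁) (Realised.size≤ ρ₂)))
    ; agrees = agrees
    }
    where open JoinCover ρ₁ ρ₂

  sound-join : ∀ {S₁ S₂} → Sound B ν₁ G₁ S₁ → Sound B ν₂ G₂ S₂ → Sound B ν₁ (joinLG G₁ G₂) (lift₂ joinW S₁ S₂)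
  sound-join {S₁} {S₂} sound₁ sound₂ w∈ with lift₂-origin _ S₁ S₂ w∈
  ... | _ , _ , w₁∈ , w₂∈ , here refl = realised-join (sound₁ w₁∈) (sound₂ w₂∈)

LG-IntroEdge-run : ∀ {k τ B i j} (r : Run k τ B) → i ∈ₛ B → j ∈ₛ B →
  LG (IntroEdge (label i) (label j) τ) ≡ withEdge (LG τ) (activeVertex r i) (activeVertex r j)
LG-IntroEdge-run {τ = τ} r i∈B j∈B = LG-IntroEdge τ (lookupLab-bag i∈B) (lookupLab-bag j∈B)
  where open WellFormed (wellFormed r)

sound : ∀ {k τ B} (r : Run k τ B) → Sound B (activeVertex r) (LG τ) (Dyn k (run⇒over r))
sound leaf                          = sound-leaf
sound (iv (lab i) r i∉B)            = sound-introVertex (wellFormed r) i∉B (sound r)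
sound (fv (lab i) r _)              = sound-forgetVertex (wellFormed r) (sound r)
sound {k} (ie (lab i) (lab j) _ r i∈B j∈B) =
  subst (λ G → Sound _ (activeVertex r) G (lift₁ (introEdgeW i j) (Dyn k (run⇒over r))))
        (sym (LG-IntroEdge-run r i∈B j∈B))
        (sound-introEdge (wellFormed r) i∈B j∈B (sound r))
sound (jn r s)                      = sound-join (wellFormed r) (wellFormed s) (sound r) (sound s)

-- Completeness of the table

-- s + |A| ≤ c + |R| is s − |R| ≤ c − |A| without truncated subtraction: an edge between two cover
-- vertices forces only one of them into R, so R may be smaller than A, but the table never pays
-- for more vertices outside R than the cover has outside A.
Witnessed : ∀ {k} → List (W k) → Subset (suc k) → ℕ → Set
Witnessed S A c = ∃ λ R → ∃ λ s → (R , s) ∈ S × R ⊆ₛ A × s + ∣ A ∣ ≤ c + ∣ R ∣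

Complete : ∀ {k} → Subset (suc k) → (Fin (suc k) → ℕ) → LGraph → List (W k) → Set
Complete B ν G S = ∀ {P A} → Covers G P → A ⊆ₛ B → Agrees B ν P A → Witnessed S A (size G P)

Dominated⇒Witnessed : ∀ {k} {S : List (W k)} {R s A c} →
  Dominated S (R , s) → R ⊆ₛ A → s + ∣ A ∣ ≤ c + ∣ R ∣ → Witnessed S A c
Dominated⇒Witnessed ((R , s′) , w∈ , refl , s′≤s) R⊆A bound =
  R , s′ , w∈ , R⊆A , ≤-trans (+-monoˡ-≤ _ s′≤s) bound

complete-leaf : ∀ {k} → Complete {k} ⊥ (λ _ → 0) (LG Leaf) ((⊥ , 0) ∷ [])
complete-leaf _ A⊆⊥ _ = ⊥ , 0 , here refl , ⊥-elim ∘ ∉⊥ , p⊆q⇒∣p∣≤∣q∣ A⊆⊥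

module _ {k} {B : Subset (suc k)} {ν : Fin (suc k) → ℕ} {G : LGraph} (wf : WellFormed B ν G) where
  open WellFormed wf

  complete-introVertex : ∀ {i S} → i ∉ₛ B → Complete B ν G S →
    Complete (B ∪ ⁅ i ⁆) (updateAt ν i (λ _ → fresh (lV G))) (withVertex G (label i)) (lift₁ (λ w → w ∷ []) S)
  complete-introVertex {i} {S} i∉B complete {P} {A} covers A⊆B∪i agrees
    with complete covers A-i⊆B agrees-A-i
    where
    A-i⊆B : A - i ⊆ₛ B
    A-i⊆B j∈ with x∈p-y⁻ j∈
    ... | j≢i , j∈A with x∈p∪⁅y⁆⁻ B (A⊆B∪i j∈A)
    ...   | inj₁ j≡i = ⊥-elim (j≢i j≡i)
    ...   | inj₂ j∈B = j∈B
    agrees-A-i : Agrees B ν P (A - i)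
    agrees-A-i {j} j∈B with updateAt-cases ν {f = λ _ → fresh (lV G)} i∉B (x∈p∪q⁺ (inj₁ j∈B))
    ... | inj₁ (refl , _)     = ⊥-elim (i∉B j∈B)
    ... | inj₂ (_ , ν′j≡νj)   =
      trans (cong P (sym ν′j≡νj)) (trans (agrees (x∈p∪q⁺ (inj₁ j∈B))) (sym (lookup-- A λ { refl → i∉B j∈B })))
  ... | R , s , w∈ , R⊆A-i , bound =
    Dominated⇒Witnessed (lift₁-dominates _ S w∈ (here refl)) (proj₂ ∘ x∈p-y⁻ ∘ R⊆A-i) bound′
    where
    x : ℕ
    x = fresh (lV G)
    Ai≡Px : lookup A i ≡ P x
    Ai≡Px = trans (sym (agrees (x∈p∪q⁺ (inj₂ (x∈⁅x⁆ i))))) (cong P (updateAt-updates i ν))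
    add-bit : ∀ s a c r b → s + a ≤ c + r → s + (a + b) ≤ (b + c) + r
    add-bit s a c r b le = begin
      s + (a + b)   ≡⟨ sym (+-assoc s a b) ⟩
      (s + a) + b   ≤⟨ +-monoˡ-≤ b le ⟩
      (c + r) + b   ≡⟨ rearrange c r b ⟩
      (b + c) + r   ∎
      where
      open ≤-Reasoning
      rearrange : ∀ c r b → (c + r) + b ≡ (b + c) + r
      rearrange = solve-∀
    bound′ : s + ∣ A ∣ ≤ (bit (P x) + size G P) + ∣ R ∣
    bound′ rewrite ∣p∣≡∣p-x∣+bit A i | Ai≡Px = add-bit s _ _ _ (bit (P x)) bound

  complete-forgetVertex : ∀ {i S} → i ∈ₛ B → Complete B ν G S →
    Complete (B - i) ν (withoutLabel G (label i)) (lift₁ (λ w → (proj₁ w - i , proj₂ w) ∷ []) S)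
  complete-forgetVertex {i} {S} i∈B complete {P} {A} covers A⊆B-i agrees
    with complete covers A⁺⊆B agrees-A⁺
    where
    A⁺ : Subset (suc k)
    A⁺ = A [ i ]≔ P (ν i)
    A⁺-old : ∀ {j} → j ≢ i → lookup A⁺ j ≡ lookup A j
    A⁺-old j≢i = lookup∘update′ j≢i A (P (ν i))
    A⁺⊆B : A⁺ ⊆ₛ B
    A⁺⊆B {j} j∈ with j Fin.≟ i
    ... | yes refl = i∈B
    ... | no j≢i   = proj₂ (x∈p-y⁻ (A⊆B-i (lookup⇒[]= j A (trans (sym (A⁺-old j≢i)) ([]=⇒lookup j∈)))))
    agrees-A⁺ : Agrees B ν P A⁺
    agrees-A⁺ {j} j∈B with j Fin.≟ i
    ... | yes refl = sym (lookup∘update i A (P (ν i)))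
    ... | no j≢i   = trans (agrees (x∈p∧x≢y⇒x∈p-y j∈B j≢i)) (sym (A⁺-old j≢i))
  ... | R , s , w∈ , R⊆A⁺ , bound =
    Dominated⇒Witnessed (lift₁-dominates _ S w∈ (here refl)) R-i⊆A bound′
    where
    A⁺ : Subset (suc k)
    A⁺ = A [ i ]≔ P (ν i)
    R-i⊆A : R - i ⊆ₛ A
    R-i⊆A {j} j∈ with x∈p-y⁻ j∈
    ... | j≢i , j∈R = lookup⇒[]= j A (trans (sym (lookup∘update′ j≢i A (P (ν i)))) ([]=⇒lookup (R⊆A⁺ j∈R)))
    Ri≤Pνi : bit (lookup R i) ≤ bit (P (ν i))
    Ri≤Pνi with lookup R i in Ri
    ... | false = z≤n
    ... | true  = ≤-reflexive (cong bit (trans (sym ([]=⇒lookup (R⊆A⁺ (lookup⇒[]= i R Ri))))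
                                               (lookup∘update i A (P (ν i)))))
    drop-bit : ∀ s a b c r rb → s + (a + b) ≤ c + (r + rb) → rb ≤ b → s + a ≤ c + r
    drop-bit s a b c r rb le rb≤b = +-cancelʳ-≤ b _ _ (begin
      (s + a) + b   ≡⟨ +-assoc s a b ⟩
      s + (a + b)   ≤⟨ le ⟩
      c + (r + rb)  ≤⟨ +-monoʳ-≤ c (+-monoʳ-≤ r rb≤b) ⟩
      c + (r + b)   ≡⟨ sym (+-assoc c r b) ⟩
      (c + r) + b   ∎)
      where open ≤-Reasoning
    bound′ : s + ∣ A ∣ ≤ size G P + ∣ R - i ∣
    bound′ = drop-bit s (∣ A ∣) (bit (P (ν i))) (size G P) (∣ R - i ∣) (bit (lookup R i))
      (subst₂ (λ a r → s + a ≤ size G P + r) (∣p[x]≔b∣ A (P (ν i)) (x∉p-x ∘ A⊆B-i)) (∣p∣≡∣p-x∣+bit R i) bound)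
      Ri≤Pνi

  complete-introEdge : ∀ {i j S} → i ∈ₛ B → j ∈ₛ B → Complete B ν G S →
    Complete B ν (withEdge G (ν i) (ν j)) (lift₁ (introEdgeW i j) S)
  complete-introEdge {i} {j} {S} i∈B j∈B complete {P} {A} covers A⊆B agrees
    with complete covers-old A⊆B agrees
    where
    covers-old : Covers G P
    covers-old e∈ with covers (there e∈)
    ... | _ , here refl , _         = ⊥-elim (fresh-∉ (lE G) e∈)
    ... | _ , there (here refl) , _ = ⊥-elim (fresh-∉ (lE G) e∈)
    ... | v , there (there p) , Pv  = v , p , Pv
  ... | R , s , w∈ , R⊆A , bound = by-cases (i ∈? R) (j ∈? R)
    where
    witness : ∀ {R′ s′} → (R′ , s′) ∈ introEdgeW i j (R , s) → R′ ⊆ₛ A → s′ + ∣ A ∣ ≤ size G P + ∣ R′ ∣ →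
      Witnessed (lift₁ (introEdgeW i j) S) A (size G P)
    witness step = Dominated⇒Witnessed (lift₁-dominates _ S w∈ step)
    extend : ∀ {u} → u ∉ₛ R → u ∈ₛ A → (R ∪ ⁅ u ⁆ , suc s) ∈ introEdgeW i j (R , s) →
      Witnessed (lift₁ (introEdgeW i j) S) A (size G P)
    extend {u} u∉R u∈A step = witness step R∪u⊆A
      (subst (λ r → suc s + ∣ A ∣ ≤ size G P + r) (sym (∣p∪⁅x⁆∣ R u∉R))
             (subst (suc s + ∣ A ∣ ≤_) (sym (+-suc _ _)) (s≤s bound)))
      where
      R∪u⊆A : R ∪ ⁅ u ⁆ ⊆ₛ A
      R∪u⊆A x∈ with x∈p∪⁅y⁆⁻ R x∈
      ... | inj₁ refl = u∈A
      ... | inj₂ x∈R  = R⊆A x∈R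
    by-cases : Dec (i ∈ₛ R) → Dec (j ∈ₛ R) → Witnessed (lift₁ (introEdgeW i j) S) A (size G P)
    by-cases (yes i∈R) _         =
      witness (subst (_ ∈_) (sym (introEdgeW-covered (inj₁ i∈R))) (here refl)) R⊆A bound
    by-cases (no _)    (yes j∈R) =
      witness (subst (_ ∈_) (sym (introEdgeW-covered (inj₂ j∈R))) (here refl)) R⊆A bound
    by-cases (no i∉R)  (no j∉R) with covers (here refl)
    ... | _ , here refl , Pνi =
      extend i∉R (lookup⇒[]= i A (trans (sym (agrees i∈B)) Pνi))
             (subst (_ ∈_) (sym (introEdgeW-uncovered i∉R j∉R)) (here refl))
    ... | _ , there (here refl) , Pνj =
      extend j∉R (lookup⇒[]= j A (trans (sym (agrees j∈B)) Pνj))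
             (subst (_ ∈_) (sym (introEdgeW-uncovered i∉R j∉R)) (there (here refl)))
    ... | _ , there (there p) , _ = ⊥-elim (fresh-∉ (lE G) (incidence-edge p))

join-bound-arith : ∀ {s₁ s₂ c a c₁ c₂ r₁ r₂ u i} → c + a ≡ c₁ + c₂ → s₁ + a ≤ c₁ + r₁ → s₂ + a ≤ c₂ + r₂ →
  u + i ≡ r₁ + r₂ → i ≤ s₁ + s₂ → (s₁ + s₂ ∸ i) + a ≤ c + u
join-bound-arith {s₁} {s₂} {c} {a} {c₁} {c₂} {r₁} {r₂} {u} {i} e h₁ h₂ e′ i≤s = +-cancelʳ-≤ (i + a) _ _ (begin
  ((s₁ + s₂ ∸ i) + a) + (i + a)   ≡⟨ rearrange₁ (s₁ + s₂ ∸ i) a i ⟩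
  ((s₁ + s₂ ∸ i) + i) + (a + a)   ≡⟨ cong (_+ (a + a)) (m∸n+n≡m i≤s) ⟩
  (s₁ + s₂) + (a + a)             ≡⟨ rearrange₂ s₁ s₂ a ⟩
  (s₁ + a) + (s₂ + a)             ≤⟨ +-mono-≤ h₁ h₂ ⟩
  (c₁ + r₁) + (c₂ + r₂)           ≡⟨ rearrange₃ c₁ r₁ c₂ r₂ ⟩
  (c₁ + c₂) + (r₁ + r₂)           ≡⟨ cong₂ _+_ (sym e) (sym e′) ⟩
  (c + a) + (u + i)               ≡⟨ rearrange₄ c a u i ⟩
  (c + u) + (i + a)               ∎)
  where
  open ≤-Reasoning
  rearrange₁ : ∀ x a i → (x + a) + (i + a) ≡ (x + i) + (a + a)
  rearrange₁ = solve-∀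
  rearrange₂ : ∀ x y a → (x + y) + (a + a) ≡ (x + a) + (y + a)
  rearrange₂ = solve-∀
  rearrange₃ : ∀ a b c d → (a + b) + (c + d) ≡ (a + c) + (b + d)
  rearrange₃ = solve-∀
  rearrange₄ : ∀ a b c d → (a + b) + (c + d) ≡ (a + c) + (d + b)
  rearrange₄ = solve-∀

module _ {k} {B : Subset (suc k)} {ν₁ ν₂ : Fin (suc k) → ℕ} {G₁ G₂ : LGraph}
         (wf₁ : WellFormed B ν₁ G₁) (wf₂ : WellFormed B ν₂ G₂) where
  open Join wf₁ wf₂
  private
    module W₁ = WellFormed wf₁
    module W₂ = WellFormed wf₂

  complete-join : ∀ {S₁ S₂} → Sound B ν₁ G₁ S₁ → Complete B ν₁ G₁ S₁ → Complete B ν₂ G₂ S₂ →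
    Complete B ν₁ (joinLG G₁ G₂) (lift₂ joinW S₁ S₂)
  complete-join {S₁} {S₂} sound₁ complete₁ complete₂ {P} {A} covers A⊆B agrees =
    combine (complete₁ (Covers-joinˡ covers) A⊆B agrees)
            (complete₂ (Covers-joinʳ covers) A⊆B (Agrees-joinʳ {P} {A} agrees))
    where
    combine : Witnessed S₁ A (size G₁ P) → Witnessed S₂ A (size G₂ (P ∘ glueVertex G₁ G₂)) →
      Witnessed (lift₂ joinW S₁ S₂) A (size (joinLG G₁ G₂) P)
    combine (R₁ , s₁ , w₁∈ , R₁⊆A , bound₁) (R₂ , s₂ , w₂∈ , R₂⊆A , bound₂) =
      Dominated⇒Witnessed (lift₂-dominates _ S₁ S₂ w₁∈ w₂∈ (here refl))
        ([ R₁⊆A , R₂⊆A ]′ ∘ x∈p∪q⁻ R₁ R₂)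
        (join-bound-arith {c₁ = size G₁ P} {size G₂ (P ∘ glueVertex G₁ G₂)} {∣ R₁ ∣} {∣ R₂ ∣}
          (size-join-split A⊆B agrees) bound₁ bound₂ (∣p∪q∣+∣p∩q∣ R₁ R₂)
          (≤-trans (∣p∩q∣≤∣p∣ R₁ R₂) (≤-trans (realised-∣R∣≤s wf₁ (sound₁ w₁∈)) (m≤m+n s₁ s₂))))

complete : ∀ {k τ B} (r : Run k τ B) → Complete B (activeVertex r) (LG τ) (Dyn k (run⇒over r))
complete leaf                         = complete-leaf
complete (iv (lab i) r i∉B)           = complete-introVertex (wellFormed r) i∉B (complete r)
complete (fv (lab i) r i∈B)           = complete-forgetVertex (wellFormed r) i∈B (complete r)
complete {k} (ie (lab i) (lab j) _ r i∈B j∈B) =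
  subst (λ G → Complete _ (activeVertex r) G (lift₁ (introEdgeW i j) (Dyn k (run⇒over r))))
        (sym (LG-IntroEdge-run r i∈B j∈B))
        (complete-introEdge (wellFormed r) i∈B j∈B (complete r))
complete (jn r s)                     =
  complete-join (wellFormed r) (wellFormed s) (sound r) (complete r) (complete s)

-- The minimum of the table

memberOf : List ℕ → ℕ → Bool
memberOf C x = isYes (x ∈ℕ? C)

underlying : LGraph → Graph
underlying G = mkGraph (lV G) (lE G) (lI G)

trace : ∀ {k} → Subset (suc k) → (Fin (suc k) → ℕ) → (ℕ → Bool) → Subset (suc k)
trace B ν P = Vec.tabulate (λ i → lookup B i ∧ P (ν i))

module _ {k} {B : Subset (suc k)} {ν : Fin (suc k) → ℕ} {G : LGraph} (wf : WellFormed B ν G) where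
  open WellFormed wf

  trace-⊆ : ∀ P → trace B ν P ⊆ₛ B
  trace-⊆ P {i} i∈ =
    lookup⇒[]= i B (∧-conicalˡ _ _ (trans (sym (lookup∘tabulate (λ j → lookup B j ∧ P (ν j)) i)) ([]=⇒lookup i∈)))

  trace-agrees : ∀ P → Agrees B ν P (trace B ν P)
  trace-agrees P {i} i∈B =
    sym (trans (lookup∘tabulate (λ j → lookup B j ∧ P (ν j)) i) (cong (_∧ P (ν i)) ([]=⇒lookup i∈B)))

  cover⇒vertexCover : ∀ {P} → Covers G P → IsVertexCover (underlying G) (filterᵇ P (lV G))
  cover⇒vertexCover {P} covers = record
    { unique = Unique.filter⁺ (T? ∘ P) vertices-unique
    ; subset = All.tabulate (proj₁ ∘ ∈-filter⁻ (T? ∘ P) {xs = lV G})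
    ; covers = λ e e∈ → let v , p , Pv = covers e∈ in
                 v , p , ∈-filter⁺ (T? ∘ P) (incidence-vertex p) (≡true⇒T Pv)
    }

  vertexCover⇒cover : ∀ {C} → IsVertexCover (underlying G) C →
    Covers G (memberOf C) × size G (memberOf C) ≤ length C
  vertexCover⇒cover {C} vc = covers′ , size≤
    where
    open IsVertexCover vc
    covers′ : Covers G (memberOf C)
    covers′ e∈ = let v , p , v∈C = covers _ e∈ in v , p , T⇒≡true (fromWitness v∈C)
    size≤ : size G (memberOf C) ≤ length C
    size≤ = subst (_≤ length C) (length-filterᵇ (memberOf C) (lV G))
      (Unique-length-≤ (Unique.filter⁺ (T? ∘ memberOf C) vertices-unique)
                       (toWitness ∘ proj₂ ∘ ∈-filter⁻ (T? ∘ memberOf C) {xs = lV G}))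

argmin-∈ : ∀ {A : Set} (f : A → ℕ) {x} xs → x ∈ xs → argmin f x xs ∈ xs
argmin-∈ f xs x∈ = [ (λ eq → subst (_∈ xs) (sym eq) x∈) , id ]′ (argmin-sel f _ xs)

module _ {k τ B} (r : Run k τ B) where
  private
    S : List (W k)
    S = Dyn k (run⇒over r)
    wf : WellFormed B (activeVertex r) (LG τ)
    wf = wellFormed r
    open WellFormed wf

  table-nonempty : ∃ λ w → w ∈ S
  table-nonempty with complete r covered-by-all (λ i∈B → i∈B) all-agree
    where
    covered-by-all : Covers (LG τ) (λ _ → true)
    covered-by-all e∈ = let v , p = edge-incidence e∈ in v , p , refl
    all-agree : Agrees B (activeVertex r) (λ _ → true) B
    all-agree i∈B = sym ([]=⇒lookup i∈B)
  ... | R , s , w∈ , _ = (R , s) , w∈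

  table-≤-vertexCover : ∀ {C} → IsVertexCover G⟦ τ ⟧ C → ∃ λ w → w ∈ S × proj₂ w ≤ length C
  table-≤-vertexCover {C} vc with vertexCover⇒cover wf vc
  ... | covers , size≤ with complete r covers (trace-⊆ wf (memberOf C)) (trace-agrees wf (memberOf C))
  ... | R , s , w∈ , R⊆A , bound =
    (R , s) , w∈ , ≤-trans (+-cancelʳ-≤ _ _ _ (≤-trans bound (+-monoʳ-≤ _ (p⊆q⇒∣p∣≤∣q∣ R⊆A)))) size≤

  table-computes-minimum : ∃ λ n → IsMinVCSize G⟦ τ ⟧ n × InvIs S n
  table-computes-minimum with table-nonempty
  ... | w₀ , w₀∈ with argmin proj₂ w₀ S | argmin-∈ proj₂ S w₀∈ | f[argmin]≤f[xs] {f = proj₂} w₀ S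
  ... | (R , s) | w∈ | minimal =
    s , ((C , vc , ≤-antisym length≤s (lower C vc)) , lower) , ∈-map⁺ proj₂ w∈ , All.map⁺ minimal
    where
    open Realised (sound r w∈)
    C : List ℕ
    C = filterᵇ cover (lV (LG τ))
    vc : IsVertexCover G⟦ τ ⟧ C
    vc = cover⇒vertexCover wf covers
    length≤s : length C ≤ s
    length≤s = subst (_≤ s) (sym (length-filterᵇ cover (lV (LG τ)))) size≤
    lower : ∀ C′ → IsVertexCover G⟦ τ ⟧ C′ → s ≤ length C′
    lower C′ vc′ = let w′ , w′∈ , w′≤ = table-≤-vertexCover vc′ in ≤-trans (All.lookup minimal w′∈) w′≤

-- Invariance under isomorphism

FinBij-sym : ∀ {A B f} (bij : FinBij A B f) → FinBij B A (FinBij.g bij)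
FinBij-sym {f = f} bij = record { g = f ; f∈ = g∈ ; g∈ = f∈ ; gf = fg ; fg = gf }
  where open FinBij bij

≃-sym : ∀ {G H} → G ≃ H → H ≃ G
≃-sym {G} {H} iso = record
  { fV   = BV.g
  ; fE   = BE.g
  ; bijV = FinBij-sym bijV
  ; bijE = FinBij-sym bijE
  ; inc→ = λ e v e∈ v∈ p → inc← (BE.g e) (BV.g v) (BE.g∈ e e∈) (BV.g∈ v v∈)
                               (subst₂ (λ e′ v′ → (e′ , v′) ∈ I H) (sym (BE.fg e e∈)) (sym (BV.fg v v∈)) p)
  ; inc← = λ e v e∈ v∈ p → subst₂ (λ e′ v′ → (e′ , v′) ∈ I H) (BE.fg e e∈) (BV.fg v v∈)
                               (inc→ (BE.g e) (BV.g v) (BE.g∈ e e∈) (BV.g∈ v v∈) p)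
  }
  where
  open _≃_ iso
  module BV = FinBij bijV
  module BE = FinBij bijE

IsVertexCover-≃ : ∀ {G H C} (iso : G ≃ H) → IsVertexCover G C → IsVertexCover H (map (_≃_.fV iso) C)
IsVertexCover-≃ {G} {H} {C} iso vc = record
  { unique = Unique-map⁺ (λ x∈ y∈ fx≡fy → trans (sym (BV.gf _ (All.lookup subset x∈)))
                                                (trans (cong BV.g fx≡fy) (BV.gf _ (All.lookup subset y∈))))
                         unique
  ; subset = All.map⁺ (All.map (BV.f∈ _) subset)
  ; covers = covers′
  }
  where
  open _≃_ iso
  open IsVertexCover vc
  module BV = FinBij bijV
  module BE = FinBij bijE
  covers′ : ∀ e → e ∈ E H → ∃ λ v → (e , v) ∈ I H × v ∈ map fV C
  covers′ e e∈ with covers (BE.g e) (BE.g∈ e e∈)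
  ... | v , p , v∈C = fV v , subst (λ e′ → (e′ , fV v) ∈ I H) (BE.fg e e∈)
                                   (inc→ _ v (BE.g∈ e e∈) (All.lookup subset v∈C) p)
                    , ∈-map⁺ fV v∈C

IsMinVCSize-≃ : ∀ {G H m n} → G ≃ H → IsMinVCSize G m → IsMinVCSize H n → m ≡ n
IsMinVCSize-≃ iso ((C , vc , refl) , G-min) ((D , vd , refl) , H-min) = ≤-antisym
  (subst (_ ≤_) (length-map _ D) (G-min _ (IsVertexCover-≃ (≃-sym iso) vd)))
  (subst (_ ≤_) (length-map _ C) (H-min _ (IsVertexCover-≃ iso vc)))

IsMinVCSize⇒InvVCIs : ∀ {G n} → IsMinVCSize G n → InvVCIs G n
IsMinVCSize⇒InvVCIs n-min k τ p _ iso =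
  subst (InvIs (Dyn k (inL⇒over p))) (IsMinVCSize-≃ iso (proj₁ (proj₂ table)) n-min) (proj₂ (proj₂ table))
  where
  table : ∃ λ m → IsMinVCSize G⟦ τ ⟧ m × InvIs (Dyn k (inL⇒over p)) m
  table = table-computes-minimum (proj₂ p)

theorem3 : ∀ (k : ℕ) (τ : Term) → τ ∈L k →
    Σ ℕ (λ n → IsMinVCSize G⟦ τ ⟧ n × InvVCIs G⟦ τ ⟧ n)
theorem3 k τ (B , r) = size-min , is-min , IsMinVCSize⇒InvVCIs is-min
  where
  size-min : ℕ
  size-min = proj₁ (table-computes-minimum r)
  is-min : IsMinVCSize G⟦ τ ⟧ size-min
  is-min = proj₁ (proj₂ (table-computes-minimum r))
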